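{- Let $\tau$ be the transfer operator of a Roman graded sequence $(p_a^\alpha(x))$, i.e. the continuous linear operator on the logarithmic algebra $\mathcal{I}$ determined by $\tau\lambda_a^\alpha(x)=p_a^\alpha(x)$ for all $a\in\mathbb{Z}$ and all logarithmic indices $\alpha$. Then its adjoint $\tau^*$ is an automorphism of the algebra $\Lambda^+$ of Artinian operators. Moreover, the adjoint of the restriction of $\tau$ to $\mathcal{I}^{(0)}$ is an automorphism of the algebra $\Lambda$ of differential operators.
   Context: Setting (discrete case of the logarithmic umbral calculus). For $a\in\mathbb{Z}$ let $\lfloor a\rceil=a$ if $a\neq0$ and $\lfloor 0\rceil=1$ (Roman number); let $\lfloor a\rceil!=a!$ for $a\ge0$ and $\lfloor a\rceil!=(-1)^{ -a-1}/(-a-1)!$ for $a<0$ (Roman factorial). The harmonic logarithms $\lambda_a^\alpha(x)$ are indexed by $a\in\mathbb{Z}$ and a logarithmic index $\alpha$: for $\alpha=(0)$, $\lambda_a^{(0)}(x)=x^a$ for $a\ge0$ and $\lambda_a^{(0)}(x)=0$ for $a<0$; for $\alpha=(1)$, $\lambda_a^{(1)}(x)=x^a(\log x-H_a)$ for $a\ge0$ ($H_a=1+\tfrac12+\dots+\tfrac1a$) and $\lambda_a^{(1)}(x)=x^a$ for $a<0$; further indices involve iterated logarithms. For each $\alpha$, $\mathcal{I}^\alpha$ is the space of formal series $\sum_{b\le N}c_b\lambda_b^\alpha(x)$ ($N\in\mathbb{Z}$, $c_b\in\mathbb{C}$), topologized by coefficientwise convergence with degrees bounded above; the logarithmic algebra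 $\mathcal{I}$ is spanned by all $\mathcal{I}^\alpha$. The derivative acts by $D\lambda_a^\alpha=\lfloor a\rceil\lambda_{a-1}^\alpha$. An Artinian operator is a formal Laurent series $f(D)=\sum_{a\ge k}c_aD^a$ ($k\in\mathbb{Z}$), acting continuously on each $\mathcal{I}^\alpha$ via $D^b\lambda_a^\alpha=\frac{\lfloor a\rceil!}{\lfloor a-b\rceil!}\lambda_{a-b}^\alpha$ ($b\in\mathbb{Z}$); these form the field $\Lambda^+$, and the differential operators $\sum_{a\ge0}c_aD^a$ form the subring $\Lambda$. The degree of a nonzero Artinian operator is the least $a$ with $c_a\ne0$; a delta operator is an Artinian operator of degree $1$. For $p\in\mathcal{I}^\alpha$, $\langle\alpha\mid p\rangle$ denotes the coefficient of $\lambda_0^\alpha$ in $p$. A graded sequence is a family $(p_a^\alpha(x))$ with $p_a^\alpha\in\mathcal{I}^\alpha$ of degree $a$ (top term a nonzero multiple of $\lambda_a^\alpha$) for $\alpha\ne(0)$, which is regular: the coefficient of $\lambda_b^\alpha$ in $p_a^\alpha$ is the same for all $\alpha\neq(0)$, and $p_a^{(0)}$ is obtained from $p_a^{(1)}$ by replacing each $\lambda_b^{(1)}$ by $\lambda_b^{(0)}$. The associated graded sequence of a delta operator $f(D)$ is the unique graded sequence with $\langle\alpha\mid p_0^\alpha\rangle=1$, $\langle\alpha\mid p_a^\alpha\rangle=0$ for $a\ne0$, and $f(D)p_a^\alpha=\lfloor a\rceil p_{a-1}^\alpha$ for all $a,\alpha$. A Roman graded sequence is the associated graded sequence of some delta operator.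 Adjoint: for a continuous linear regular operator $\theta$ on $\mathcal{I}$ (mapping each $\mathcal{I}^\alpha$ into itself, with the same matrix in the bases $(\lambda_b^\alpha)_b$ for all $\alpha\ne(0)$ and the corresponding action on $\mathcal{I}^{(0)}$), the adjoint $\theta^*:\Lambda^+\to\Lambda^+$ is defined by $\langle\alpha\mid(\theta^*f)(D)\,p\rangle=\langle\alpha\mid f(D)\theta p\rangle$ for all $\alpha\neq(0)$, $p\in\mathcal{I}^\alpha$, $f\in\Lambda^+$; the adjoint of a continuous linear operator on $\mathcal{I}^{(0)}$ is the map $\Lambda\to\Lambda$ defined by the same identity with $\alpha=(0)$, $p\in\mathcal{I}^{(0)}$, $f\in\Lambda$. -}

module Defs where

open import Level using (Level; _⊔_) renaming (suc to lsuc)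
open import Data.Bool using (if_then_else_)
open import Data.Nat as ℕ using (ℕ; zero; suc; _!)
open import Data.Nat.Properties using (_!≢0)
open import Data.Integer as ℤ using (ℤ; +_; -[1+_]; _≤?_; _≟_)
open import Data.Rational as ℚ using (ℚ; _/_)
open import Data.Product using (Σ; ∃; _×_)
open import Relation.Nullary using (¬_; does)
open import Relation.Binary.PropositionalEquality using (_≢_)
open import Algebra.Bundles using (CommutativeRing)
open import Algebra.Morphism.Structures using (IsRingHomomorphism)

⌊_⌉ : ℤ → ℚ
⌊ + zero ⌉ = ℚ.1ℚ
⌊ a ⌉ = a / 1

⌊_⌉! : ℤ → ℚ
⌊ + n ⌉! = (+ (n !)) / 1
⌊ -[1+ n ] ⌉! = (((ℤ.- (+ 1)) ℤ.^ n) / (n !)) {{n !≢0}}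

⌊_⌉!⁻¹ : ℤ → ℚ
⌊ + n ⌉!⁻¹ = ((+ 1) / (n !)) {{n !≢0}}
⌊ -[1+ n ] ⌉!⁻¹ = (((ℤ.- (+ 1)) ℤ.^ n) ℤ.* (+ (n !))) / 1

-- the coefficient ⌊a⌉!/⌊a-b⌉! in  D^b λ_a = (⌊a⌉!/⌊a-b⌉!) λ_{a-b}
Dcoeff : ℤ → ℤ → ℚ
Dcoeff a b = ⌊ a ⌉! ℚ.* ⌊ a ℤ.- b ⌉!⁻¹

-- Coefficient field: a field of characteristic zero, given together with
-- its (unique) embedding of ℚ.  ℂ is an instance.

record CZField (c ℓ : Level) : Set (lsuc (c ⊔ ℓ)) where
  field
    K : CommutativeRing c ℓ
  open CommutativeRing K public
  field
    ι     : ℚ → Carrier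
    ι-hom : IsRingHomomorphism ℚ.+-*-rawRing rawRing ι
    1≉0   : ¬ (1# ≈ 0#)
    inv   : ∀ x → ¬ (x ≈ 0#) → ∃ λ y → x * y ≈ 1#

clamp : ℤ → ℕ
clamp (+ n) = n
clamp -[1+ n ] = 0

module Theory {c ℓ : Level} (F : CZField c ℓ) where
  open CZField F

  sumN : ℤ → ℕ → (ℤ → Carrier) → Carrier
  sumN lo zero g = 0#
  sumN lo (suc n) g = g lo + sumN (lo ℤ.+ + 1) n g

  sumZ : ℤ → ℤ → (ℤ → Carrier) → Carrier
  sumZ lo hi g = sumN lo (clamp (hi ℤ.- lo ℤ.+ + 1)) g

  -- I^α (α ≠ (0)) : formal series Σ_{b ≤ top} c_b λ_b^α.
  -- By regularity all I^α, α ≠ (0), are identified with coefficient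
  -- sequences in the basis (λ_b^α)_b.
  record Ser : Set c where
    field
      top   : ℤ
      coeff : ℤ → Carrier

  open Ser public

  atS : Ser → ℤ → Carrier
  atS s b = if does (b ≤? top s) then coeff s b else 0#

  -- for α = (0): λ_b^(0) = 0 when b < 0, so only b ≥ 0 coefficients count
  atS0 : Ser → ℤ → Carrier
  atS0 s b = if does (+ 0 ≤? b) then atS s b else 0#

  _≋_ : Ser → Ser → Set ℓ
  s ≋ t = ∀ b → atS s b ≈ atS t b

  _≋₀_ : Ser → Ser → Set ℓ
  s ≋₀ t = ∀ b → atS0 s b ≈ atS0 t b

  scaleS : Carrier → Ser → Ser
  scaleS k s = record { top = top s ; coeff = λ b → k * atS s b }

  ⟨_⟩ : Ser → Carrier
  ⟨ s ⟩ = atS s (+ 0)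

  ⟨_⟩₀ : Ser → Carrier
  ⟨ s ⟩₀ = atS0 s (+ 0)

  -- Artinian operators Λ⁺ : Σ_{a ≥ low} c_a D^a
  record Art : Set c where
    field
      low  : ℤ
      coef : ℤ → Carrier

  open Art public

  atA : Art → ℤ → Carrier
  atA f a = if does (low f ≤? a) then coef f a else 0#

  _≈A_ : Art → Art → Set ℓ
  f ≈A g = ∀ a → atA f a ≈ atA g a

  _+A_ : Art → Art → Art
  f +A g = record { low = low f ℤ.⊓ low g ; coef = λ a → atA f a + atA g a }

  _*A_ : Art → Art → Art
  f *A g = record
    { low  = low f ℤ.+ low g
    ; coef = λ n → sumZ (low f) (n ℤ.- low g) (λ a → atA f a * atA g (n ℤ.- a)) }

  _·A_ : Carrier → Art → Art
  k ·A f = record { low = low f ; coef = λ a → k * atA f a }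

  1A : Art
  1A = record { low = + 0 ; coef = λ a → if does (a ≟ + 0) then 1# else 0# }

  IsDiff : Art → Set ℓ
  IsDiff f = ∀ a → a ℤ.< + 0 → atA f a ≈ 0#

  IsDelta : Art → Set ℓ
  IsDelta f = (∀ a → a ℤ.< + 1 → atA f a ≈ 0#) × ¬ (atA f (+ 1) ≈ 0#)

  -- action on I^α (α ≠ (0)):  f(D) (Σ_a c_a λ_a) = Σ_{a,b} f_b c_a ⌊a⌉!/⌊a-b⌉! λ_{a-b}
  act : Art → Ser → Ser
  act f p = record
    { top   = top p ℤ.- low f
    ; coeff = λ j → sumZ (low f) (top p ℤ.- j)
                      (λ b → atA f b * (atS p (j ℤ.+ b) * ι (Dcoeff (j ℤ.+ b) b))) }

  act₀ : Art → Ser → Ser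
  act₀ f p = record
    { top   = top p ℤ.- low f
    ; coeff = λ j → sumZ (low f) (top p ℤ.- j)
                      (λ b → atA f b * (atS0 p (j ℤ.+ b) * ι (Dcoeff (j ℤ.+ b) b))) }

  -- graded sequences: p a = p_a^α for α ≠ (0); p_a^(0) is p a read in I^(0)

  record IsAssociated (f : Art) (p : ℤ → Ser) : Set (c ⊔ ℓ) where
    field
      degree-above : ∀ a b → a ℤ.< b → atS (p a) b ≈ 0#
      degree-top   : ∀ a → ¬ (atS (p a) a ≈ 0#)
      norm-0       : ⟨ p (+ 0) ⟩ ≈ 1#
      norm-≠0      : ∀ a → a ≢ + 0 → ⟨ p a ⟩ ≈ 0#
      norm₀-0      : ⟨ p (+ 0) ⟩₀ ≈ 1#
      norm₀-≠0     : ∀ a → a ≢ + 0 → ⟨ p a ⟩₀ ≈ 0#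
      lowering     : ∀ a → act f (p a) ≋ scaleS (ι ⌊ a ⌉) (p (a ℤ.- + 1))
      lowering₀    : ∀ a → act₀ f (p a) ≋₀ scaleS (ι ⌊ a ⌉) (p (a ℤ.- + 1))

  IsRoman : (ℤ → Ser) → Set (c ⊔ ℓ)
  IsRoman p = Σ Art λ f → IsDelta f × IsAssociated f p

  -- transfer operator τ λ_a^α = p_a^α  (continuous linear extension)
  transfer : (ℤ → Ser) → Ser → Ser
  transfer p s = record
    { top   = top s
    ; coeff = λ j → sumZ j (top s) (λ b → atS s b * atS (p b) j) }

  transfer₀ : (ℤ → Ser) → Ser → Ser
  transfer₀ p s = record
    { top   = top s
    ; coeff = λ j → sumZ j (top s) (λ b → atS0 s b * atS0 (p b) j) }

  IsAdjoint : (Ser → Ser) → (Art → Art) → Set (c ⊔ ℓ)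
  IsAdjoint θ g = ∀ f q → ⟨ act (g f) q ⟩ ≈ ⟨ act f (θ q) ⟩

  IsAdjoint₀ : (Ser → Ser) → (Art → Art) → Set (c ⊔ ℓ)
  IsAdjoint₀ θ g = ∀ f → IsDiff f →
    IsDiff (g f) × (∀ q → ⟨ act₀ (g f) q ⟩₀ ≈ ⟨ act₀ f (θ q) ⟩₀)

  record IsAutΛ⁺ (g : Art → Art) : Set (c ⊔ ℓ) where
    field
      cong    : ∀ f h → f ≈A h → g f ≈A g h
      +-homo  : ∀ f h → g (f +A h) ≈A (g f +A g h)
      ·-homo  : ∀ k f → g (k ·A f) ≈A (k ·A g f)
      *-homo  : ∀ f h → g (f *A h) ≈A (g f *A g h)
      1-homo  : g 1A ≈A 1A
      injective  : ∀ f h → g f ≈A g h → f ≈A h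
      surjective : ∀ h → ∃ λ f → g f ≈A h

  record IsAutΛ (g : Art → Art) : Set (c ⊔ ℓ) where
    field
      closed  : ∀ f → IsDiff f → IsDiff (g f)
      cong    : ∀ f h → IsDiff f → IsDiff h → f ≈A h → g f ≈A g h
      +-homo  : ∀ f h → IsDiff f → IsDiff h → g (f +A h) ≈A (g f +A g h)
      ·-homo  : ∀ k f → IsDiff f → g (k ·A f) ≈A (k ·A g f)
      *-homo  : ∀ f h → IsDiff f → IsDiff h → g (f *A h) ≈A (g f *A g h)
      1-homo  : g 1A ≈A 1A
      injective  : ∀ f h → IsDiff f → IsDiff h → g f ≈A g h → f ≈A h
      surjective : ∀ h → IsDiff h → ∃ λ f → IsDiff f × (g f ≈A h)

-- The pairing of an Artinian operator h with a series q is ⟨ h(D) q ⟩ = Σ_b h_b q_b ⌊b⌉!, so the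
-- adjoint of τ is forced to be (τ* h)_c = Σ_{b ≤ c} h_b M c b, where M c b is ⌊c⌉!⁻¹ ⌊b⌉! times
-- the coefficient of λ_b in p_c.
-- Since p_c has degree c, M is lower triangular with invertible diagonal, so τ* is bijective.
-- It is linear, and τ* 1 = 1 because ⟨ p_c ⟩ = δ_c0. Multiplicativity reduces to the convolution
-- identity M n (a + e) = Σ_c M c a M (n - c) e: both sides satisfy the recurrence
-- Σ_x f_x S n (a + x) = S (n - 1) a inherited from f(D) p_c = ⌊c⌉ p_(c-1) and agree at a = 0,
-- so they agree everywhere by induction on n - e - a. The same τ* maps Λ into Λ, and a differential
-- operator only pairs with the λ_b, b ≥ 0, on which I^(0) and the other I^α agree.
module Submission where

open import Level using (Level)
open import Data.Bool using (if_then_else_)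
open import Data.Empty using (⊥-elim)
open import Data.Nat as ℕ using (ℕ; zero; suc; _!)
open import Data.Nat.Properties using (_!≢0)
import Data.Nat.Properties as ℕP
open import Data.Nat.Induction using (<-rec)
open import Data.Integer as ℤ using (ℤ; +_; -[1+_])
import Data.Integer.Properties as ℤP
open import Data.Integer.Tactic.RingSolver using (solve-∀)
open import Data.Rational as ℚ using (_/_)
import Data.Rational.Properties as ℚP
import Data.Rational.Unnormalised as ℚᵘ
import Data.Rational.Unnormalised.Properties as ℚᵘP
open import Data.Product using (Σ; ∃; _×_; _,_; proj₁; proj₂)
open import Relation.Nullary using (¬_; yes; no; does; Dec)
open import Relation.Nullary.Decidable using (dec-true; dec-false)
open import Relation.Binary.PropositionalEquality as ≡ using (_≡_; _≢_; ≢-sym)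
open import Algebra.Morphism.Structures using (IsRingHomomorphism)
open import Defs

i-j+j≡i : ∀ i j → i ℤ.- j ℤ.+ j ≡ i
i-j+j≡i = solve-∀

i+j-j≡i : ∀ i j → i ℤ.+ j ℤ.- j ≡ i
i+j-j≡i = solve-∀

i+j-i≡j : ∀ i j → i ℤ.+ j ℤ.- i ≡ j
i+j-i≡j = solve-∀

≤⇒≡+ : ∀ {i j} → i ℤ.≤ j → ∃ λ k → j ≡ i ℤ.+ + k
≤⇒≡+ {i} {j} i≤j =
  ℤ.∣ j ℤ.- i ∣ , ≡.trans (j≡i+[j-i] i j)
                     (≡.cong (λ x → i ℤ.+ x) (≡.sym (ℤP.0≤i⇒+∣i∣≡i (ℤP.i≤j⇒0≤j-i i≤j))))
  where
  j≡i+[j-i] : ∀ i j → j ≡ i ℤ.+ (j ℤ.- i)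
  j≡i+[j-i] = solve-∀

i<i+[1+k] : ∀ i k → i ℤ.< i ℤ.+ + suc k
i<i+[1+k] i k = ≡.subst (ℤ._< i ℤ.+ + suc k) (ℤP.+-identityʳ i) (ℤP.+-monoʳ-< i (ℤ.+<+ (ℕ.s≤s ℕ.z≤n)))

i<j+[1+k]⇒i≤j+k : ∀ {i} j k → i ℤ.< j ℤ.+ + suc k → i ℤ.≤ j ℤ.+ + k
i<j+[1+k]⇒i≤j+k {i} j k i<j+1+k = ≡.subst (i ℤ.≤_) (pred-+suc j (+ k)) (ℤP.i<j⇒i≤pred[j] i<j+1+k)
  where
  pred-+suc : ∀ j k → ℤ.- + 1 ℤ.+ (j ℤ.+ (+ 1 ℤ.+ k)) ≡ j ℤ.+ k
  pred-+suc = solve-∀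

i≤j+k⇒i<j+[1+k] : ∀ {i} j k → i ℤ.≤ j ℤ.+ + k → i ℤ.< j ℤ.+ + suc k
i≤j+k⇒i<j+[1+k] j k i≤j+k = ℤP.≤-<-trans i≤j+k (ℤP.+-monoʳ-< j (ℤ.+<+ (ℕP.n<1+n k)))

i+1≤j⇒i<j : ∀ {i j} → i ℤ.+ + 1 ℤ.≤ j → i ℤ.< j
i+1≤j⇒i<j {i} i+1≤j = ℤP.suc[i]≤j⇒i<j (≡.subst (ℤ._≤ _) (ℤP.+-comm i (+ 1)) i+1≤j)

i≤j-1⇒i<j : ∀ {i j} → i ℤ.≤ j ℤ.- + 1 → i ℤ.< j
i≤j-1⇒i<j {i} {j} i≤j-1 = i+1≤j⇒i<j (≡.subst (i ℤ.+ + 1 ℤ.≤_) (i-j+j≡i j (+ 1)) (ℤP.+-monoˡ-≤ (+ 1) i≤j-1))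

i+j≤i+k⇒j≤k : ∀ i {j k} → i ℤ.+ j ℤ.≤ i ℤ.+ k → j ℤ.≤ k
i+j≤i+k⇒j≤k i {j} {k} i+j≤i+k = ≡.subst₂ ℤ._≤_ (cancel i j) (cancel i k) (ℤP.+-monoʳ-≤ (ℤ.- i) i+j≤i+k)
  where
  cancel : ∀ i j → ℤ.- i ℤ.+ (i ℤ.+ j) ≡ j
  cancel = solve-∀

i-j<k⇒i-k<j : ∀ i j k → i ℤ.- j ℤ.< k → i ℤ.- k ℤ.< j
i-j<k⇒i-k<j i j k i-j<k = ≡.subst₂ ℤ._<_ (reassoc i j k) (cancel j k) (ℤP.+-monoˡ-< (j ℤ.- k) i-j<k)
  where
  reassoc : ∀ i j k → i ℤ.- j ℤ.+ (j ℤ.- k) ≡ i ℤ.- k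
  reassoc = solve-∀
  cancel : ∀ j k → k ℤ.+ (j ℤ.- k) ≡ j
  cancel = solve-∀

i-j<k⇒i<j+k : ∀ i j k → i ℤ.- j ℤ.< k → i ℤ.< j ℤ.+ k
i-j<k⇒i<j+k i j k i-j<k = ≡.subst₂ ℤ._<_ (i-j+j≡i i j) (ℤP.+-comm k j) (ℤP.+-monoˡ-< j i-j<k)

i<j+k⇒i-j<k : ∀ i j k → i ℤ.< j ℤ.+ k → i ℤ.- j ℤ.< k
i<j+k⇒i-j<k i j k i<j+k = ≡.subst (i ℤ.- j ℤ.<_) (i+j-i≡j j k) (ℤP.+-monoˡ-< (ℤ.- j) i<j+k)

i-j≤i-k : ∀ i {j k} → k ℤ.≤ j → i ℤ.- j ℤ.≤ i ℤ.- k
i-j≤i-k i k≤j = ℤP.+-monoʳ-≤ i (ℤP.neg-mono-≤ k≤j)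

toℚᵘ-/ : ∀ i d .{{_ : ℕ.NonZero d}} → ℚ.toℚᵘ (i / d) ℚᵘ.≃ (i ℚᵘ./ d)
toℚᵘ-/ i (suc d) = ℚP.toℚᵘ-fromℚᵘ (ℚᵘ.mkℚᵘ i d)

/*/≡/ : ∀ i d j e k m .{{_ : ℕ.NonZero d}} .{{_ : ℕ.NonZero e}} .{{_ : ℕ.NonZero m}} →
      (i ℤ.* j) ℤ.* + m ≡ k ℤ.* (+ d ℤ.* + e) → (i / d) ℚ.* (j / e) ≡ k / m
/*/≡/ i d@(suc _) j e@(suc _) k m@(suc _) eq = ℚP.toℚᵘ-injective (begin
  ℚ.toℚᵘ ((i / d) ℚ.* (j / e))
    ≈⟨ ℚP.toℚᵘ-homo-* (i / d) (j / e) ⟩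
  ℚ.toℚᵘ (i / d) ℚᵘ.* ℚ.toℚᵘ (j / e)
    ≈⟨ ℚᵘP.*-cong (toℚᵘ-/ i d) (toℚᵘ-/ j e) ⟩
  (i ℚᵘ./ d) ℚᵘ.* (j ℚᵘ./ e)
    ≈⟨ ℚᵘ.*≡* (≡.trans eq (≡.cong (λ x → k ℤ.* x) (≡.sym (ℤP.pos-* d e)))) ⟩
  k ℚᵘ./ m
    ≈⟨ ℚᵘP.≃-sym (toℚᵘ-/ k m) ⟩
  ℚ.toℚᵘ (k / m) ∎)
  where open ℚᵘP.≃-Reasoning

[-1]^n*[-1]^n≡1 : ∀ n → (ℤ.- + 1) ℤ.^ n ℤ.* (ℤ.- + 1) ℤ.^ n ≡ + 1
[-1]^n*[-1]^n≡1 zero = ≡.refl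
[-1]^n*[-1]^n≡1 (suc n) = ≡.trans (sign² ((ℤ.- + 1) ℤ.^ n)) ([-1]^n*[-1]^n≡1 n)
  where
  sign² : ∀ s → (ℤ.- + 1 ℤ.* s) ℤ.* (ℤ.- + 1 ℤ.* s) ≡ s ℤ.* s
  sign² = solve-∀

⌊a⌉!⁻¹*⌊a⌉!≡1 : ∀ a → ⌊ a ⌉!⁻¹ ℚ.* ⌊ a ⌉! ≡ ℚ.1ℚ
⌊a⌉!⁻¹*⌊a⌉!≡1 (+ n) = /*/≡/ (+ 1) (n !) (+ (n !)) 1 (+ 1) 1 {{n !≢0}} (rearrange (+ (n !)))
  where
  rearrange : ∀ N → (+ 1 ℤ.* N) ℤ.* + 1 ≡ + 1 ℤ.* (N ℤ.* + 1)
  rearrange = solve-∀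
⌊a⌉!⁻¹*⌊a⌉!≡1 -[1+ n ] = /*/≡/ (s ℤ.* + (n !)) 1 s (n !) (+ 1) 1 {{_}} {{n !≢0}} (begin
  ((s ℤ.* + (n !)) ℤ.* s) ℤ.* + 1  ≡⟨ rearrange s (+ (n !)) ⟩
  (s ℤ.* s) ℤ.* (+ 1 ℤ.* + (n !))  ≡⟨ ≡.cong (ℤ._* (+ 1 ℤ.* + (n !))) ([-1]^n*[-1]^n≡1 n) ⟩
  + 1 ℤ.* (+ 1 ℤ.* + (n !))        ∎)
  where
  open ≡.≡-Reasoning
  s = (ℤ.- + 1) ℤ.^ n
  rearrange : ∀ s N → ((s ℤ.* N) ℤ.* s) ℤ.* + 1 ≡ (s ℤ.* s) ℤ.* (+ 1 ℤ.* N)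
  rearrange = solve-∀

⌊a⌉!⁻¹*⌊a⌉≡⌊a-1⌉!⁻¹ : ∀ a → ⌊ a ⌉!⁻¹ ℚ.* ⌊ a ⌉ ≡ ⌊ a ℤ.- + 1 ⌉!⁻¹
⌊a⌉!⁻¹*⌊a⌉≡⌊a-1⌉!⁻¹ (+ zero) = ≡.refl
⌊a⌉!⁻¹*⌊a⌉≡⌊a-1⌉!⁻¹ (+ suc n) =
  /*/≡/ (+ 1) (suc n !) (+ suc n) 1 (+ 1) (n !) {{suc n !≢0}} {{_}} {{n !≢0}} (begin
    (+ 1 ℤ.* + suc n) ℤ.* + (n !)         ≡⟨ rearrange (+ suc n) (+ (n !)) ⟩
    + 1 ℤ.* ((+ suc n ℤ.* + (n !)) ℤ.* + 1) ≡⟨ ≡.cong (λ x → + 1 ℤ.* (x ℤ.* + 1)) (ℤP.pos-* (suc n) (n !)) ⟨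
    + 1 ℤ.* (+ (suc n !) ℤ.* + 1)          ∎)
  where
  open ≡.≡-Reasoning
  rearrange : ∀ m N → (+ 1 ℤ.* m) ℤ.* N ≡ + 1 ℤ.* ((m ℤ.* N) ℤ.* + 1)
  rearrange = solve-∀
⌊a⌉!⁻¹*⌊a⌉≡⌊a-1⌉!⁻¹ -[1+ n ] rewrite ℕP.+-identityʳ n =
  /*/≡/ (s ℤ.* + (n !)) 1 -[1+ n ] 1 (ℤ.- + 1 ℤ.* s ℤ.* + (suc n !)) 1 (begin
    ((s ℤ.* + (n !)) ℤ.* ℤ.- + suc n) ℤ.* + 1
      ≡⟨ rearrange s (+ (n !)) (+ suc n) ⟩
    (ℤ.- + 1 ℤ.* s ℤ.* (+ suc n ℤ.* + (n !))) ℤ.* (+ 1 ℤ.* + 1)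
      ≡⟨ ≡.cong (λ x → (ℤ.- + 1 ℤ.* s ℤ.* x) ℤ.* (+ 1 ℤ.* + 1)) (ℤP.pos-* (suc n) (n !)) ⟨
    (ℤ.- + 1 ℤ.* s ℤ.* + (suc n !)) ℤ.* (+ 1 ℤ.* + 1) ∎)
  where
  open ≡.≡-Reasoning
  s = (ℤ.- + 1) ℤ.^ n
  rearrange : ∀ s N m → ((s ℤ.* N) ℤ.* ℤ.- m) ℤ.* + 1 ≡ (ℤ.- + 1 ℤ.* s ℤ.* (m ℤ.* N)) ℤ.* (+ 1 ℤ.* + 1)
  rearrange = solve-∀

module Arithmetic {c ℓ : Level} (F : CZField c ℓ) where
  open CZField F
  open import Algebra.Properties.Monoid *-monoid using (cancelʳ)

  x≈0⇒x*y≈0 : ∀ {x y} → x ≈ 0# → x * y ≈ 0#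
  x≈0⇒x*y≈0 x≈0 = trans (*-congʳ x≈0) (zeroˡ _)

  y≈0⇒x*y≈0 : ∀ {x y} → y ≈ 0# → x * y ≈ 0#
  y≈0⇒x*y≈0 y≈0 = trans (*-congˡ y≈0) (zeroʳ _)

  *-cancelʳ-invertible : ∀ {u v} x y → u * v ≈ 1# → x * u ≈ y * u → x ≈ y
  *-cancelʳ-invertible x y uv≈1 xu≈yu =
    trans (sym (cancelʳ uv≈1 x)) (trans (*-congʳ xu≈yu) (cancelʳ uv≈1 y))

  *-cancelˡ-invertible : ∀ {u v} x y → u * v ≈ 1# → u * x ≈ u * y → x ≈ y
  *-cancelˡ-invertible x y uv≈1 ux≈uy = *-cancelʳ-invertible x y uv≈1 (trans (*-comm _ _) (trans ux≈uy (*-comm _ _)))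

clamp-nonpos : ∀ i → i ℤ.≤ + 0 → clamp i ≡ 0
clamp-nonpos (+ zero)  _ = ≡.refl
clamp-nonpos (+ suc n) (ℤ.+≤+ ())
clamp-nonpos -[1+ n ]  _ = ≡.refl

module Sums {c ℓ : Level} (F : CZField c ℓ) where
  open CZField F
  open Theory F
  open import Relation.Binary.Reasoning.Setoid setoid
  open import Algebra.Properties.CommutativeSemigroup +-commutativeSemigroup
    using () renaming (interchange to +-interchange)

  sumN-cong : ∀ lo n {g h : ℤ → Carrier} →
              (∀ i → lo ℤ.≤ i → i ℤ.< lo ℤ.+ + n → g i ≈ h i) → sumN lo n g ≈ sumN lo n h
  sumN-cong lo zero    g≈h = refl
  sumN-cong lo (suc n) g≈h = +-cong (g≈h lo ℤP.≤-refl (i<i+[1+k] lo n))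
    (sumN-cong (lo ℤ.+ + 1) n λ i lo+1≤i i<hi →
      g≈h i (ℤP.≤-trans (ℤP.i≤i+j lo (+ 1)) lo+1≤i) (≡.subst (i ℤ.<_) (ℤP.+-assoc lo (+ 1) (+ n)) i<hi))

  sumN-zero : ∀ lo n → sumN lo n (λ _ → 0#) ≈ 0#
  sumN-zero lo zero    = refl
  sumN-zero lo (suc n) = trans (+-identityˡ _) (sumN-zero (lo ℤ.+ + 1) n)

  sumN-+ : ∀ lo n (g h : ℤ → Carrier) → sumN lo n (λ i → g i + h i) ≈ sumN lo n g + sumN lo n h
  sumN-+ lo zero    g h = sym (+-identityˡ 0#)
  sumN-+ lo (suc n) g h = trans (+-congˡ (sumN-+ (lo ℤ.+ + 1) n g h)) (+-interchange _ _ _ _)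

  *-distribˡ-sumN : ∀ lo n k (g : ℤ → Carrier) → k * sumN lo n g ≈ sumN lo n (λ i → k * g i)
  *-distribˡ-sumN lo zero    k g = zeroʳ k
  *-distribˡ-sumN lo (suc n) k g = trans (distribˡ k _ _) (+-congˡ (*-distribˡ-sumN (lo ℤ.+ + 1) n k g))

  sumN-swap : ∀ lo₁ n₁ lo₂ n₂ (g : ℤ → ℤ → Carrier) →
              sumN lo₁ n₁ (λ i → sumN lo₂ n₂ (g i)) ≈ sumN lo₂ n₂ (λ j → sumN lo₁ n₁ (λ i → g i j))
  sumN-swap lo₁ zero    lo₂ n₂ g = sym (sumN-zero lo₂ n₂)
  sumN-swap lo₁ (suc n₁) lo₂ n₂ g =
    trans (+-congˡ (sumN-swap (lo₁ ℤ.+ + 1) n₁ lo₂ n₂ g)) (sym (sumN-+ lo₂ n₂ (g lo₁) _))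

  sumN-shift : ∀ lo n s (g : ℤ → Carrier) → sumN lo n (λ i → g (i ℤ.+ s)) ≈ sumN (lo ℤ.+ s) n g
  sumN-shift lo zero    s g = refl
  sumN-shift lo (suc n) s g = +-congˡ (trans (sumN-shift (lo ℤ.+ + 1) n s g)
    (reflexive (≡.cong (λ l → sumN l n g) (swap lo s))))
    where
    swap : ∀ lo s → (lo ℤ.+ + 1) ℤ.+ s ≡ (lo ℤ.+ s) ℤ.+ + 1
    swap = solve-∀

  sumN-++ : ∀ lo m n (g : ℤ → Carrier) → sumN lo (m ℕ.+ n) g ≈ sumN lo m g + sumN (lo ℤ.+ + m) n g
  sumN-++ lo zero    n g = sym (trans (+-identityˡ _) (reflexive (≡.cong (λ l → sumN l n g) (ℤP.+-identityʳ lo))))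
  sumN-++ lo (suc m) n g = begin
    g lo + sumN (lo ℤ.+ + 1) (m ℕ.+ n) g
      ≈⟨ +-congˡ (sumN-++ (lo ℤ.+ + 1) m n g) ⟩
    g lo + (sumN (lo ℤ.+ + 1) m g + sumN ((lo ℤ.+ + 1) ℤ.+ + m) n g)
      ≈⟨ +-assoc _ _ _ ⟨
    g lo + sumN (lo ℤ.+ + 1) m g + sumN ((lo ℤ.+ + 1) ℤ.+ + m) n g
      ≡⟨ ≡.cong (λ l → g lo + sumN (lo ℤ.+ + 1) m g + sumN l n g) (ℤP.+-assoc lo (+ 1) (+ m)) ⟩
    g lo + sumN (lo ℤ.+ + 1) m g + sumN (lo ℤ.+ + suc m) n g ∎

  rangeLength : ℤ → ℤ → ℕ
  rangeLength lo hi = clamp (hi ℤ.- lo ℤ.+ + 1)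

  sumZ-bounds : ∀ {lo lo′ hi hi′} (g : ℤ → Carrier) → lo ≡ lo′ → hi ≡ hi′ → sumZ lo hi g ≈ sumZ lo′ hi′ g
  sumZ-bounds g ≡.refl ≡.refl = refl

  sumZ-by-length : ∀ lo hi k (g : ℤ → Carrier) → rangeLength lo hi ≡ k → sumZ lo hi g ≈ sumN lo k g
  sumZ-by-length lo hi k g len = reflexive (≡.cong (λ n → sumN lo n g) len)

  sumZ-empty : ∀ lo hi (g : ℤ → Carrier) → hi ℤ.< lo → sumZ lo hi g ≈ 0#
  sumZ-empty lo hi g hi<lo = sumZ-by-length lo hi 0 g (clamp-nonpos _ len≤0)
    where
    len≤0 : hi ℤ.- lo ℤ.+ + 1 ℤ.≤ + 0
    len≤0 = ≡.subst (ℤ._≤ + 0) (reorder hi lo) (ℤP.i≤j⇒i-j≤0 (ℤP.i<j⇒suc[i]≤j hi<lo))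
      where
      reorder : ∀ hi lo → (+ 1 ℤ.+ hi) ℤ.- lo ≡ hi ℤ.- lo ℤ.+ + 1
      reorder = solve-∀

  sumZ-singleton : ∀ i (g : ℤ → Carrier) → sumZ i i g ≈ g i
  sumZ-singleton i g = trans (sumZ-by-length i i 1 g (≡.cong clamp (len i))) (+-identityʳ (g i))
    where
    len : ∀ i → i ℤ.- i ℤ.+ + 1 ≡ + 1
    len = solve-∀

  sumZ-nonempty : ∀ lo k (g : ℤ → Carrier) → sumZ lo (lo ℤ.+ + k) g ≈ sumN lo (suc k) g
  sumZ-nonempty lo k g = sumZ-by-length lo (lo ℤ.+ + k) (suc k) g (≡.cong clamp (len lo (+ k)))
    where
    len : ∀ lo k → lo ℤ.+ k ℤ.- lo ℤ.+ + 1 ≡ + 1 ℤ.+ k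
    len = solve-∀

  sumZ-cong-on : ∀ lo hi {g h : ℤ → Carrier} →
                 (∀ i → lo ℤ.≤ i → i ℤ.≤ hi → g i ≈ h i) → sumZ lo hi g ≈ sumZ lo hi h
  sumZ-cong-on lo hi {g} {h} g≈h with lo ℤ.≤? hi
  ... | no lo≰hi = trans (sumZ-empty lo hi g (ℤP.≰⇒> lo≰hi)) (sym (sumZ-empty lo hi h (ℤP.≰⇒> lo≰hi)))
  ... | yes lo≤hi with ≤⇒≡+ lo≤hi
  ... | k , ≡.refl = begin
    sumZ lo (lo ℤ.+ + k) g  ≈⟨ sumZ-nonempty lo k g ⟩
    sumN lo (suc k) g       ≈⟨ sumN-cong lo (suc k) (λ i lo≤i i<hi → g≈h i lo≤i (i<j+[1+k]⇒i≤j+k lo k i<hi)) ⟩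
    sumN lo (suc k) h       ≈⟨ sumZ-nonempty lo k h ⟨
    sumZ lo (lo ℤ.+ + k) h  ∎

  sumZ-cong : ∀ lo hi {g h : ℤ → Carrier} → (∀ i → g i ≈ h i) → sumZ lo hi g ≈ sumZ lo hi h
  sumZ-cong lo hi g≈h = sumN-cong lo (rangeLength lo hi) (λ i _ _ → g≈h i)

  sumZ-zero : ∀ lo hi {g : ℤ → Carrier} → (∀ i → lo ℤ.≤ i → i ℤ.≤ hi → g i ≈ 0#) → sumZ lo hi g ≈ 0#
  sumZ-zero lo hi g≈0 = trans (sumZ-cong-on lo hi g≈0) (sumN-zero lo (rangeLength lo hi))

  sumZ-+ : ∀ lo hi (g h : ℤ → Carrier) → sumZ lo hi (λ i → g i + h i) ≈ sumZ lo hi g + sumZ lo hi h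
  sumZ-+ lo hi = sumN-+ lo (rangeLength lo hi)

  *-distribˡ-sumZ : ∀ lo hi k (g : ℤ → Carrier) → k * sumZ lo hi g ≈ sumZ lo hi (λ i → k * g i)
  *-distribˡ-sumZ lo hi = *-distribˡ-sumN lo (rangeLength lo hi)

  *-distribʳ-sumZ : ∀ lo hi k (g : ℤ → Carrier) → sumZ lo hi g * k ≈ sumZ lo hi (λ i → g i * k)
  *-distribʳ-sumZ lo hi k g =
    trans (*-comm _ k) (trans (*-distribˡ-sumZ lo hi k g) (sumZ-cong lo hi (λ i → *-comm k (g i))))

  sumZ-swap : ∀ lo₁ hi₁ lo₂ hi₂ (g : ℤ → ℤ → Carrier) →
              sumZ lo₁ hi₁ (λ i → sumZ lo₂ hi₂ (g i)) ≈ sumZ lo₂ hi₂ (λ j → sumZ lo₁ hi₁ (λ i → g i j))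
  sumZ-swap lo₁ hi₁ lo₂ hi₂ = sumN-swap lo₁ (rangeLength lo₁ hi₁) lo₂ (rangeLength lo₂ hi₂)

  sumZ-*-sumZ : ∀ lo₁ hi₁ lo₂ hi₂ (g h : ℤ → Carrier) →
                sumZ lo₁ hi₁ g * sumZ lo₂ hi₂ h ≈ sumZ lo₁ hi₁ (λ i → sumZ lo₂ hi₂ (λ j → g i * h j))
  sumZ-*-sumZ lo₁ hi₁ lo₂ hi₂ g h =
    trans (*-distribʳ-sumZ lo₁ hi₁ _ g) (sumZ-cong lo₁ hi₁ (λ i → *-distribˡ-sumZ lo₂ hi₂ (g i) h))

  sumZ-shift : ∀ lo hi s (g : ℤ → Carrier) → sumZ lo hi (λ i → g (i ℤ.+ s)) ≈ sumZ (lo ℤ.+ s) (hi ℤ.+ s) g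
  sumZ-shift lo hi s g =
    trans (sumN-shift lo (rangeLength lo hi) s g)
          (sym (sumZ-by-length (lo ℤ.+ s) (hi ℤ.+ s) (rangeLength lo hi) g (≡.cong clamp (len hi lo s))))
    where
    len : ∀ hi lo s → (hi ℤ.+ s) ℤ.- (lo ℤ.+ s) ℤ.+ + 1 ≡ hi ℤ.- lo ℤ.+ + 1
    len = solve-∀

  sumZ-split : ∀ lo m hi (g : ℤ → Carrier) → lo ℤ.≤ m ℤ.+ + 1 → m ℤ.≤ hi →
               sumZ lo hi g ≈ sumZ lo m g + sumZ (m ℤ.+ + 1) hi g
  sumZ-split lo m hi g lo≤m+1 m≤hi with ≤⇒≡+ m≤hi
  ... | b , ≡.refl = begin
    sumZ lo (m ℤ.+ + b) g
      ≈⟨ sumZ-by-length lo (m ℤ.+ + b) (a ℕ.+ b) g (≡.cong clamp len) ⟩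
    sumN lo (a ℕ.+ b) g
      ≈⟨ sumN-++ lo a b g ⟩
    sumN lo a g + sumN (lo ℤ.+ + a) b g
      ≈⟨ +-cong (sumZ-by-length lo m a g (≡.cong clamp lenˡ))
        (reflexive (≡.cong (λ l → sumN l b g) (≡.sym lo+a≡m+1))) ⟨
    sumZ lo m g + sumN (m ℤ.+ + 1) b g
      ≈⟨ +-congˡ (sumZ-by-length (m ℤ.+ + 1) (m ℤ.+ + b) b g (≡.cong clamp (lenʳ m (+ b)))) ⟨
    sumZ lo m g + sumZ (m ℤ.+ + 1) (m ℤ.+ + b) g ∎
    where
    a = ℤ.∣ m ℤ.+ + 1 ℤ.- lo ∣
    +a : + a ≡ m ℤ.+ + 1 ℤ.- lo
    +a = ℤP.0≤i⇒+∣i∣≡i (ℤP.i≤j⇒0≤j-i lo≤m+1)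
    len : m ℤ.+ + b ℤ.- lo ℤ.+ + 1 ≡ + a ℤ.+ + b
    len = ≡.trans (reorder m (+ b) lo) (≡.cong (ℤ._+ + b) (≡.sym +a))
      where
      reorder : ∀ m b lo → m ℤ.+ b ℤ.- lo ℤ.+ + 1 ≡ (m ℤ.+ + 1 ℤ.- lo) ℤ.+ b
      reorder = solve-∀
    lenˡ : m ℤ.- lo ℤ.+ + 1 ≡ + a
    lenˡ = ≡.trans (reorder m lo) (≡.sym +a)
      where
      reorder : ∀ m lo → m ℤ.- lo ℤ.+ + 1 ≡ m ℤ.+ + 1 ℤ.- lo
      reorder = solve-∀
    lo+a≡m+1 : lo ℤ.+ + a ≡ m ℤ.+ + 1
    lo+a≡m+1 = ≡.trans (≡.cong (λ x → lo ℤ.+ x) +a) (cancel lo m)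
      where
      cancel : ∀ lo m → lo ℤ.+ (m ℤ.+ + 1 ℤ.- lo) ≡ m ℤ.+ + 1
      cancel = solve-∀
    lenʳ : ∀ m b → m ℤ.+ b ℤ.- (m ℤ.+ + 1) ℤ.+ + 1 ≡ b
    lenʳ = solve-∀

  sumZ-extendʳ : ∀ lo hi H (g : ℤ → Carrier) → hi ℤ.≤ H → (∀ i → hi ℤ.< i → i ℤ.≤ H → g i ≈ 0#) →
                 sumZ lo H g ≈ sumZ lo hi g
  sumZ-extendʳ lo hi H g hi≤H g≈0 with lo ℤ.≤? hi ℤ.+ + 1
  ... | yes lo≤hi+1 = begin
    sumZ lo H g
      ≈⟨ sumZ-split lo hi H g lo≤hi+1 hi≤H ⟩
    sumZ lo hi g + sumZ (hi ℤ.+ + 1) H g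
      ≈⟨ +-congˡ (sumZ-zero (hi ℤ.+ + 1) H λ i hi+1≤i → g≈0 i (i+1≤j⇒i<j hi+1≤i)) ⟩
    sumZ lo hi g + 0#
      ≈⟨ +-identityʳ _ ⟩
    sumZ lo hi g ∎
  ... | no lo≰hi+1 = trans (sumZ-zero lo H λ i lo≤i → g≈0 i (ℤP.<-≤-trans hi<lo lo≤i))
                           (sym (sumZ-empty lo hi g hi<lo))
    where
    hi<lo : hi ℤ.< lo
    hi<lo = ℤP.<-trans (i<i+[1+k] hi 0) (ℤP.≰⇒> lo≰hi+1)

  sumZ-extendˡ : ∀ L lo hi (g : ℤ → Carrier) → L ℤ.≤ lo → (∀ i → L ℤ.≤ i → i ℤ.< lo → g i ≈ 0#) →
                 sumZ L hi g ≈ sumZ lo hi g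
  sumZ-extendˡ L lo hi g L≤lo g≈0 with lo ℤ.≤? hi ℤ.+ + 1
  ... | yes lo≤hi+1 = begin
    sumZ L hi g
      ≈⟨ sumZ-split L (lo ℤ.- + 1) hi g L≤lo-1+1 lo-1≤hi ⟩
    sumZ L (lo ℤ.- + 1) g + sumZ (lo ℤ.- + 1 ℤ.+ + 1) hi g
      ≈⟨ +-cong (sumZ-zero L (lo ℤ.- + 1) λ i L≤i i≤lo-1 → g≈0 i L≤i (i≤j-1⇒i<j i≤lo-1))
        (sumZ-bounds {hi = hi} g (i-j+j≡i lo (+ 1)) ≡.refl) ⟩
    0# + sumZ lo hi g
      ≈⟨ +-identityˡ _ ⟩
    sumZ lo hi g ∎
    where
    L≤lo-1+1 : L ℤ.≤ lo ℤ.- + 1 ℤ.+ + 1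
    L≤lo-1+1 = ≡.subst (L ℤ.≤_) (≡.sym (i-j+j≡i lo (+ 1))) L≤lo
    lo-1≤hi : lo ℤ.- + 1 ℤ.≤ hi
    lo-1≤hi = ≡.subst (lo ℤ.- + 1 ℤ.≤_) (i+j-j≡i hi (+ 1)) (ℤP.+-monoˡ-≤ (ℤ.- + 1) lo≤hi+1)
  ... | no lo≰hi+1 = trans (sumZ-zero L hi λ i L≤i i≤hi → g≈0 i L≤i (ℤP.≤-<-trans i≤hi hi<lo))
                           (sym (sumZ-empty lo hi g hi<lo))
    where
    hi<lo : hi ℤ.< lo
    hi<lo = ℤP.<-trans (i<i+[1+k] hi 0) (ℤP.≰⇒> lo≰hi+1)

  sumZ-restrict : ∀ L lo hi H (g : ℤ → Carrier) → L ℤ.≤ lo → hi ℤ.≤ H →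
                  (∀ i → L ℤ.≤ i → i ℤ.< lo → g i ≈ 0#) → (∀ i → hi ℤ.< i → i ℤ.≤ H → g i ≈ 0#) →
                  sumZ L H g ≈ sumZ lo hi g
  sumZ-restrict L lo hi H g L≤lo hi≤H below above =
    trans (sumZ-extendˡ L lo H g L≤lo below) (sumZ-extendʳ lo hi H g hi≤H above)

  sumZ-single : ∀ lo hi k (g : ℤ → Carrier) → lo ℤ.≤ k → k ℤ.≤ hi →
                (∀ i → lo ℤ.≤ i → i ℤ.≤ hi → i ≢ k → g i ≈ 0#) → sumZ lo hi g ≈ g k
  sumZ-single lo hi k g lo≤k k≤hi g≈0 = trans
    (sumZ-restrict lo k k hi g lo≤k k≤hi
      (λ i lo≤i i<k → g≈0 i lo≤i (ℤP.<⇒≤ (ℤP.<-≤-trans i<k k≤hi)) (ℤP.<⇒≢ i<k))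
      (λ i k<i i≤hi → g≈0 i (ℤP.≤-trans lo≤k (ℤP.<⇒≤ k<i)) i≤hi (≢-sym (ℤP.<⇒≢ k<i))))
    (sumZ-singleton k g)

  sumZ-first : ∀ lo hi (g : ℤ → Carrier) → lo ℤ.≤ hi → sumZ lo hi g ≈ g lo + sumZ (lo ℤ.+ + 1) hi g
  sumZ-first lo hi g lo≤hi =
    trans (sumZ-split lo lo hi g (ℤP.<⇒≤ (i<i+[1+k] lo 0)) lo≤hi) (+-congʳ (sumZ-singleton lo g))

  sumZ-last : ∀ lo hi (g : ℤ → Carrier) → lo ℤ.≤ hi → sumZ lo hi g ≈ sumZ lo (hi ℤ.- + 1) g + g hi
  sumZ-last lo hi g lo≤hi = trans
    (sumZ-split lo (hi ℤ.- + 1) hi g (≡.subst (lo ℤ.≤_) (≡.sym (i-j+j≡i hi (+ 1))) lo≤hi) (ℤP.i-j≤i hi (+ 1)))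
    (+-congˡ (trans (sumZ-bounds {hi = hi} g (i-j+j≡i hi (+ 1)) ≡.refl) (sumZ-singleton hi g)))

module Operators {c ℓ : Level} (F : CZField c ℓ) where
  open CZField F
  open Theory F
  open Arithmetic F
  open Sums F
  open import Relation.Binary.Reasoning.Setoid setoid
  module ι = IsRingHomomorphism ι-hom

  fact : ℤ → Carrier
  fact b = ι ⌊ b ⌉!

  fact⁻¹ : ℤ → Carrier
  fact⁻¹ b = ι ⌊ b ⌉!⁻¹

  fact⁻¹*fact≈1 : ∀ b → fact⁻¹ b * fact b ≈ 1#
  fact⁻¹*fact≈1 b = trans (sym (ι.*-homo _ _)) (trans (reflexive (≡.cong ι (⌊a⌉!⁻¹*⌊a⌉!≡1 b))) ι.1#-homo)

  fact*fact⁻¹≈1 : ∀ b → fact b * fact⁻¹ b ≈ 1#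
  fact*fact⁻¹≈1 b = trans (*-comm _ _) (fact⁻¹*fact≈1 b)

  fact⁻¹*⌊⌉≈fact⁻¹[-1] : ∀ b → fact⁻¹ b * ι ⌊ b ⌉ ≈ fact⁻¹ (b ℤ.- + 1)
  fact⁻¹*⌊⌉≈fact⁻¹[-1] b = trans (sym (ι.*-homo _ _)) (reflexive (≡.cong ι (⌊a⌉!⁻¹*⌊a⌉≡⌊a-1⌉!⁻¹ b)))

  ι-Dcoeff : ∀ j b → ι (Dcoeff (j ℤ.+ b) b) ≈ fact (j ℤ.+ b) * fact⁻¹ j
  ι-Dcoeff j b = trans (reflexive (≡.cong (λ i → ι (⌊ j ℤ.+ b ⌉! ℚ.* ⌊ i ⌉!⁻¹)) (i+j-j≡i j b))) (ι.*-homo _ _)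

  ι-Dcoeff-0 : ∀ b → ι (Dcoeff (+ 0 ℤ.+ b) b) ≈ fact b
  ι-Dcoeff-0 b = trans (ι-Dcoeff (+ 0) b)
    (trans (*-cong (reflexive (≡.cong fact (ℤP.+-identityˡ b))) ι.1#-homo) (*-identityʳ _))

  atA-below : ∀ h {a} → a ℤ.< low h → atA h a ≈ 0#
  atA-below h {a} a<low with low h ℤ.≤? a
  ... | yes low≤a = ⊥-elim (ℤP.<⇒≱ a<low low≤a)
  ... | no _      = refl

  atA-from : ∀ h {a} → low h ℤ.≤ a → atA h a ≡ coef h a
  atA-from h {a} low≤a with low h ℤ.≤? a
  ... | yes _    = ≡.refl
  ... | no low≰a = ⊥-elim (low≰a low≤a)

  atS-above : ∀ s {b} → top s ℤ.< b → atS s b ≈ 0#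
  atS-above s {b} top<b with b ℤ.≤? top s
  ... | yes b≤top = ⊥-elim (ℤP.<⇒≱ top<b b≤top)
  ... | no _      = refl

  atS-upto : ∀ s {b} → b ℤ.≤ top s → atS s b ≡ coeff s b
  atS-upto s {b} b≤top with b ℤ.≤? top s
  ... | yes _    = ≡.refl
  ... | no b≰top = ⊥-elim (b≰top b≤top)

  atS0-nonneg : ∀ s {b} → + 0 ℤ.≤ b → atS0 s b ≡ atS s b
  atS0-nonneg s {b} 0≤b with + 0 ℤ.≤? b
  ... | yes _  = ≡.refl
  ... | no 0≰b = ⊥-elim (0≰b 0≤b)

  atS0-above : ∀ s {b} → top s ℤ.< b → atS0 s b ≈ 0#
  atS0-above s {b} top<b with + 0 ℤ.≤? b
  ... | yes _ = atS-above s top<b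
  ... | no _  = refl

  atA-+A : ∀ f h a → atA (f +A h) a ≈ atA f a + atA h a
  atA-+A f h a with (low f ℤ.⊓ low h) ℤ.≤? a
  ... | yes _ = refl
  ... | no low≰a = sym (trans (+-cong (atA-below f (ℤP.<-≤-trans a<low (ℤP.i⊓j≤i _ _)))
                                      (atA-below h (ℤP.<-≤-trans a<low (ℤP.i⊓j≤j _ _))))
                              (+-identityˡ 0#))
    where a<low = ℤP.≰⇒> low≰a

  atA-·A : ∀ k f a → atA (k ·A f) a ≈ k * atA f a
  atA-·A k f a with low f ℤ.≤? a
  ... | yes _ = refl
  ... | no _  = sym (zeroʳ k)

  atA-*A : ∀ f h n L H → L ℤ.≤ low f → n ℤ.- low h ℤ.≤ H →
           atA (f *A h) n ≈ sumZ L H (λ a → atA f a * atA h (n ℤ.- a))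
  atA-*A f h n L H L≤low n-low≤H with (low f ℤ.+ low h) ℤ.≤? n
  ... | yes _ = sym (sumZ-restrict L (low f) (n ℤ.- low h) H _ L≤low n-low≤H
                      (λ a _ a<low → x≈0⇒x*y≈0 (atA-below f a<low))
                      (λ a n-low<a _ → y≈0⇒x*y≈0 (atA-below h (i-j<k⇒i-k<j n (low h) a n-low<a))))
  ... | no ≰n = sym (sumZ-zero L H λ a _ _ → term-zero a)
    where
    term-zero : ∀ a → atA f a * atA h (n ℤ.- a) ≈ 0#
    term-zero a with a ℤ.<? low f
    ... | yes a<low = x≈0⇒x*y≈0 (atA-below f a<low)
    ... | no a≮low  = y≈0⇒x*y≈0 (atA-below h (ℤP.≤-<-trans (i-j≤i-k n (ℤP.≮⇒≥ a≮low))
                                                (i<j+k⇒i-j<k n (low f) (low h) (ℤP.≰⇒> ≰n))))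

  +A-cong : ∀ {f f′ h h′} → f ≈A f′ → h ≈A h′ → (f +A h) ≈A (f′ +A h′)
  +A-cong {f} {f′} {h} {h′} f≈f′ h≈h′ a =
    trans (atA-+A f h a) (trans (+-cong (f≈f′ a) (h≈h′ a)) (sym (atA-+A f′ h′ a)))

  ·A-cong : ∀ k {f f′} → f ≈A f′ → (k ·A f) ≈A (k ·A f′)
  ·A-cong k {f} {f′} f≈f′ a = trans (atA-·A k f a) (trans (*-congˡ (f≈f′ a)) (sym (atA-·A k f′ a)))

  *A-cong : ∀ {f f′ h h′} → f ≈A f′ → h ≈A h′ → (f *A h) ≈A (f′ *A h′)
  *A-cong {f} {f′} {h} {h′} f≈f′ h≈h′ n = begin
    atA (f *A h) n                                 ≈⟨ atA-*A f h n L H (ℤP.i⊓j≤i _ _) (ℤP.i≤i⊔j _ _) ⟩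
    sumZ L H (λ a → atA f a * atA h (n ℤ.- a))     ≈⟨ sumZ-cong L H (λ a → *-cong (f≈f′ a) (h≈h′ (n ℤ.- a))) ⟩
    sumZ L H (λ a → atA f′ a * atA h′ (n ℤ.- a))   ≈⟨ atA-*A f′ h′ n L H (ℤP.i⊓j≤j _ _) (ℤP.i≤j⊔i _ _) ⟨
    atA (f′ *A h′) n                               ∎
    where
    L = low f ℤ.⊓ low f′
    H = (n ℤ.- low h) ℤ.⊔ (n ℤ.- low h′)

  atA-1A-≢0 : ∀ {a} → a ≢ + 0 → atA 1A a ≈ 0#
  atA-1A-≢0 {a} a≢0 with + 0 ℤ.≤? a | a ℤ.≟ + 0
  ... | no _  | _        = refl
  ... | yes _ | no _     = refl
  ... | yes _ | yes a≡0  = ⊥-elim (a≢0 a≡0)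

  atS-scaleS : ∀ k s j → atS (scaleS k s) j ≈ k * atS s j
  atS-scaleS k s j with j ℤ.≤? top s
  ... | yes _ = refl
  ... | no _  = sym (zeroʳ k)

  IsDelta⇒low≤1 : ∀ f → IsDelta f → low f ℤ.≤ + 1
  IsDelta⇒low≤1 f δ = ℤP.≮⇒≥ λ 1<low → proj₂ δ (atA-below f 1<low)

  IsDiff-resp : ∀ {f h} → f ≈A h → IsDiff f → IsDiff h
  IsDiff-resp f≈h f-diff a a<0 = trans (sym (f≈h a)) (f-diff a a<0)

  0≤low⇒IsDiff : ∀ f → + 0 ℤ.≤ low f → IsDiff f
  0≤low⇒IsDiff f 0≤low a a<0 = atA-below f (ℤP.<-≤-trans a<0 0≤low)

  IsDiff-+A : ∀ f h → IsDiff f → IsDiff h → IsDiff (f +A h)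
  IsDiff-+A f h f-diff h-diff a a<0 = trans (atA-+A f h a) (trans (+-cong (f-diff a a<0) (h-diff a a<0)) (+-identityˡ 0#))

  IsDiff-·A : ∀ k f → IsDiff f → IsDiff (k ·A f)
  IsDiff-·A k f f-diff a a<0 = trans (atA-·A k f a) (trans (*-congˡ (f-diff a a<0)) (zeroʳ k))

  IsDiff-*A : ∀ f h → IsDiff f → IsDiff h → IsDiff (f *A h)
  IsDiff-*A f h f-diff h-diff n n<0 =
    trans (atA-*A f h n (low f) (n ℤ.- low h) ℤP.≤-refl ℤP.≤-refl)
          (sumZ-zero (low f) (n ℤ.- low h) λ a _ _ → term-zero a)
    where
    term-zero : ∀ a → atA f a * atA h (n ℤ.- a) ≈ 0#
    term-zero a with a ℤ.<? + 0
    ... | yes a<0 = x≈0⇒x*y≈0 (f-diff a a<0)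
    ... | no a≮0  = y≈0⇒x*y≈0 (h-diff (n ℤ.- a) (ℤP.≤-<-trans (i-j≤i-k n (ℤP.≮⇒≥ a≮0))
                                                   (≡.subst (ℤ._< + 0) (≡.sym (ℤP.+-identityʳ n)) n<0)))

  IsDiff-1A : IsDiff 1A
  IsDiff-1A = 0≤low⇒IsDiff 1A ℤP.≤-refl

  IsAutΛ⁺-resp : ∀ {g g′} → (∀ h → g h ≈A g′ h) → IsAutΛ⁺ g → IsAutΛ⁺ g′
  IsAutΛ⁺-resp {g} {g′} g≈g′ aut = record
    { cong       = λ f h f≈h a →
        trans (sym (g≈g′ f a)) (trans (A.cong f h f≈h a) (g≈g′ h a))
    ; +-homo     = λ f h a → trans (sym (g≈g′ (f +A h) a))
        (trans (A.+-homo f h a) (+A-cong {g f} {g′ f} {g h} {g′ h} (g≈g′ f) (g≈g′ h) a))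
    ; ·-homo     = λ k f a → trans (sym (g≈g′ (k ·A f) a))
        (trans (A.·-homo k f a) (·A-cong k {g f} {g′ f} (g≈g′ f) a))
    ; *-homo     = λ f h a → trans (sym (g≈g′ (f *A h) a))
        (trans (A.*-homo f h a) (*A-cong {g f} {g′ f} {g h} {g′ h} (g≈g′ f) (g≈g′ h) a))
    ; 1-homo     = λ a → trans (sym (g≈g′ 1A a)) (A.1-homo a)
    ; injective  = λ f h g′f≈g′h → A.injective f h λ a →
        trans (g≈g′ f a) (trans (g′f≈g′h a) (sym (g≈g′ h a)))
    ; surjective = λ h → let (f , gf≈h) = A.surjective h in
        f , λ a → trans (sym (g≈g′ f a)) (gf≈h a)
    }
    where module A = IsAutΛ⁺ aut

  IsAutΛ-resp : ∀ {g g′} → (∀ h → IsDiff h → g h ≈A g′ h) → IsAutΛ g → IsAutΛ g′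
  IsAutΛ-resp {g} {g′} g≈g′ aut = record
    { closed     = λ f f-diff → IsDiff-resp {g f} {g′ f} (g≈g′ f f-diff) (A.closed f f-diff)
    ; cong       = λ f h f-diff h-diff f≈h a →
        trans (sym (g≈g′ f f-diff a)) (trans (A.cong f h f-diff h-diff f≈h a) (g≈g′ h h-diff a))
    ; +-homo     = λ f h f-diff h-diff a → trans (sym (g≈g′ (f +A h) (IsDiff-+A f h f-diff h-diff) a))
        (trans (A.+-homo f h f-diff h-diff a) (+A-cong {g f} {g′ f} {g h} {g′ h} (g≈g′ f f-diff) (g≈g′ h h-diff) a))
    ; ·-homo     = λ k f f-diff a → trans (sym (g≈g′ (k ·A f) (IsDiff-·A k f f-diff) a))
        (trans (A.·-homo k f f-diff a) (·A-cong k {g f} {g′ f} (g≈g′ f f-diff) a))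
    ; *-homo     = λ f h f-diff h-diff a → trans (sym (g≈g′ (f *A h) (IsDiff-*A f h f-diff h-diff) a))
        (trans (A.*-homo f h f-diff h-diff a) (*A-cong {g f} {g′ f} {g h} {g′ h} (g≈g′ f f-diff) (g≈g′ h h-diff) a))
    ; 1-homo     = λ a → trans (sym (g≈g′ 1A IsDiff-1A a)) (A.1-homo a)
    ; injective  = λ f h f-diff h-diff g′f≈g′h → A.injective f h f-diff h-diff λ a →
        trans (g≈g′ f f-diff a) (trans (g′f≈g′h a) (sym (g≈g′ h h-diff a)))
    ; surjective = λ h h-diff → let (f , f-diff , gf≈h) = A.surjective h h-diff in
        f , f-diff , λ a → trans (sym (g≈g′ f f-diff a)) (gf≈h a)
    }
    where module A = IsAutΛ aut

  atS-act : ∀ h q j → atS (act h q) j ≈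
            sumZ (low h) (top q ℤ.- j) (λ b → atA h b * (atS q (j ℤ.+ b) * ι (Dcoeff (j ℤ.+ b) b)))
  atS-act h q j with j ℤ.≤? top q ℤ.- low h
  ... | yes _ = refl
  ... | no j≰ = sym (sumZ-empty (low h) (top q ℤ.- j) _ (i-j<k⇒i-k<j (top q) (low h) j (ℤP.≰⇒> j≰)))

  atS-act₀ : ∀ h q j → atS (act₀ h q) j ≈
             sumZ (low h) (top q ℤ.- j) (λ b → atA h b * (atS0 q (j ℤ.+ b) * ι (Dcoeff (j ℤ.+ b) b)))
  atS-act₀ h q j with j ℤ.≤? top q ℤ.- low h
  ... | yes _ = refl
  ... | no j≰ = sym (sumZ-empty (low h) (top q ℤ.- j) _ (i-j<k⇒i-k<j (top q) (low h) j (ℤP.≰⇒> j≰)))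

  ⟨act⟩-expansion : ∀ h q → ⟨ act h q ⟩ ≈ sumZ (low h) (top q) (λ b → atA h b * (atS q b * fact b))
  ⟨act⟩-expansion h q = trans (atS-act h q (+ 0)) (trans (sumZ-bounds _ ≡.refl (ℤP.+-identityʳ (top q)))
    (sumZ-cong (low h) (top q) λ b →
      *-congˡ (*-cong (reflexive (≡.cong (atS q) (ℤP.+-identityˡ b))) (ι-Dcoeff-0 b))))

  ⟨act₀⟩₀-expansion : ∀ h q → ⟨ act₀ h q ⟩₀ ≈ sumZ (low h) (top q) (λ b → atA h b * (atS0 q b * fact b))
  ⟨act₀⟩₀-expansion h q = trans (atS-act₀ h q (+ 0)) (trans (sumZ-bounds _ ≡.refl (ℤP.+-identityʳ (top q)))
    (sumZ-cong (low h) (top q) λ b →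
      *-congˡ (*-cong (reflexive (≡.cong (atS0 q) (ℤP.+-identityˡ b))) (ι-Dcoeff-0 b))))

  -- q ∈ I^(0) seen in I^(α): the coefficients of λ_b, b < 0, which λ^(0) kills, are dropped.
  restrict₀ : Ser → Ser
  restrict₀ q = record { top = top q ; coeff = atS0 q }

  atS-restrict₀ : ∀ q b → atS (restrict₀ q) b ≈ atS0 q b
  atS-restrict₀ q b = by-cases (b ℤ.≤? top q)
    where
    by-cases : Dec (b ℤ.≤ top q) → atS (restrict₀ q) b ≈ atS0 q b
    by-cases (yes b≤top) = reflexive (atS-upto (restrict₀ q) b≤top)
    by-cases (no b≰top)  = trans (atS-above (restrict₀ q) (ℤP.≰⇒> b≰top)) (sym (atS0-above q (ℤP.≰⇒> b≰top)))

  ⟨act₀⟩₀≈⟨act-restrict₀⟩ : ∀ h q → ⟨ act₀ h q ⟩₀ ≈ ⟨ act h (restrict₀ q) ⟩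
  ⟨act₀⟩₀≈⟨act-restrict₀⟩ h q = trans (⟨act₀⟩₀-expansion h q) (trans
    (sumZ-cong (low h) (top q) λ b → *-congˡ (*-congʳ (sym (atS-restrict₀ q b))))
    (sym (⟨act⟩-expansion h (restrict₀ q))))

  basis : ℤ → Ser
  basis c = record { top = c ; coeff = λ b → if does (b ℤ.≟ c) then 1# else 0# }

  atS-basis-≡ : ∀ c → atS (basis c) c ≈ 1#
  atS-basis-≡ c with c ℤ.≤? c | c ℤ.≟ c
  ... | no c≰c | _       = ⊥-elim (c≰c ℤP.≤-refl)
  ... | yes _  | yes _   = refl
  ... | yes _  | no c≢c  = ⊥-elim (c≢c ≡.refl)

  atS-basis-≢ : ∀ {b c} → b ≢ c → atS (basis c) b ≈ 0#
  atS-basis-≢ {b} {c} b≢c with b ℤ.≤? c | b ℤ.≟ c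
  ... | no _  | _       = refl
  ... | yes _ | no _    = refl
  ... | yes _ | yes b≡c = ⊥-elim (b≢c b≡c)

  sumZ-pick : ∀ h c (X : ℤ → Carrier) → X c ≈ 1# → (∀ b → b ≢ c → X b ≈ 0#) →
              sumZ (low h) c (λ b → atA h b * (X b * fact b)) ≈ atA h c * fact c
  sumZ-pick h c X Xc≈1 X≈0 = by-cases (low h ℤ.≤? c)
    where
    by-cases : Dec (low h ℤ.≤ c) → sumZ (low h) c (λ b → atA h b * (X b * fact b)) ≈ atA h c * fact c
    by-cases (yes low≤c) = trans
      (sumZ-single (low h) c c _ low≤c ℤP.≤-refl λ b _ _ b≢c →
        y≈0⇒x*y≈0 (x≈0⇒x*y≈0 (X≈0 b b≢c)))
      (*-congˡ (trans (*-congʳ Xc≈1) (*-identityˡ _)))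
    by-cases (no low≰c) =
      trans (sumZ-empty (low h) c _ (ℤP.≰⇒> low≰c)) (sym (x≈0⇒x*y≈0 (atA-below h (ℤP.≰⇒> low≰c))))

  ⟨act-basis⟩ : ∀ h c → ⟨ act h (basis c) ⟩ ≈ atA h c * fact c
  ⟨act-basis⟩ h c = trans (⟨act⟩-expansion h (basis c))
    (sumZ-pick h c (atS (basis c)) (atS-basis-≡ c) (λ _ → atS-basis-≢))

  ⟨act₀-basis⟩₀ : ∀ h c → + 0 ℤ.≤ c → ⟨ act₀ h (basis c) ⟩₀ ≈ atA h c * fact c
  ⟨act₀-basis⟩₀ h c 0≤c = trans (⟨act₀⟩₀-expansion h (basis c))
    (sumZ-pick h c (atS0 (basis c)) (trans (reflexive (atS0-nonneg (basis c) 0≤c)) (atS-basis-≡ c)) X≈0)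
    where
    X≈0 : ∀ b → b ≢ c → atS0 (basis c) b ≈ 0#
    X≈0 b b≢c with + 0 ℤ.≤? b
    ... | yes _ = atS-basis-≢ b≢c
    ... | no _  = refl

  ≈A-by-basis : ∀ g g′ → (∀ c → ⟨ act g (basis c) ⟩ ≈ ⟨ act g′ (basis c) ⟩) → g ≈A g′
  ≈A-by-basis g g′ eq c = *-cancelʳ-invertible _ _ (fact*fact⁻¹≈1 c)
    (trans (sym (⟨act-basis⟩ g c)) (trans (eq c) (⟨act-basis⟩ g′ c)))

  ≈A-by-basis₀ : ∀ g g′ → IsDiff g → IsDiff g′ →
                 (∀ c → + 0 ℤ.≤ c → ⟨ act₀ g (basis c) ⟩₀ ≈ ⟨ act₀ g′ (basis c) ⟩₀) → g ≈A g′
  ≈A-by-basis₀ g g′ g-diff g′-diff eq c with c ℤ.<? + 0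
  ... | yes c<0 = trans (g-diff c c<0) (sym (g′-diff c c<0))
  ... | no c≮0  = *-cancelʳ-invertible _ _ (fact*fact⁻¹≈1 c)
    (trans (sym (⟨act₀-basis⟩₀ g c 0≤c)) (trans (eq c 0≤c) (⟨act₀-basis⟩₀ g′ c 0≤c)))
    where 0≤c = ℤP.≮⇒≥ c≮0

module Triangular {c ℓ : Level} (F : CZField c ℓ) where
  open CZField F
  open Theory F
  open Arithmetic F
  open Sums F
  open import Relation.Binary.Reasoning.Setoid setoid
  open import Algebra.Properties.Ring ring using (+-cancelˡ)

  module System (L : ℤ) (M : ℤ → ℤ → Carrier) (M⁻¹ : ℤ → Carrier) (M*M⁻¹≈1 : ∀ c → M c c * M⁻¹ c ≈ 1#) where

    lowerSum : (ℤ → Carrier) → ℤ → Carrier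
    lowerSum u c = sumZ L c (λ b → u b * M c b)

    triangular-injective : ∀ u v → (∀ c → L ℤ.≤ c → lowerSum u c ≈ lowerSum v c) → ∀ b → L ℤ.≤ b → u b ≈ v b
    triangular-injective u v u≈v b L≤b with ≤⇒≡+ L≤b
    ... | k , ≡.refl = agree-below (suc k) (L ℤ.+ + k) L≤b (i≤j+k⇒i<j+[1+k] L k ℤP.≤-refl)
      where
      agree-below : ∀ k b → L ℤ.≤ b → b ℤ.< L ℤ.+ + k → u b ≈ v b
      agree-below zero    b L≤b b<L+0 = ⊥-elim (ℤP.<⇒≱ (≡.subst (b ℤ.<_) (ℤP.+-identityʳ L) b<L+0) L≤b)
      agree-below (suc k) b L≤b b<L+1+k with b ℤ.≟ L ℤ.+ + k
      ... | no b≢L+k = agree-below k b L≤b (ℤP.≤∧≢⇒< (i<j+[1+k]⇒i≤j+k L k b<L+1+k) b≢L+k)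
      ... | yes ≡.refl = *-cancelʳ-invertible _ _ (M*M⁻¹≈1 b) (+-cancelˡ (S u) _ _ (begin
        S u + u b * M b b
          ≈⟨ sumZ-last L b _ L≤b ⟨
        lowerSum u b
          ≈⟨ u≈v b L≤b ⟩
        lowerSum v b
          ≈⟨ sumZ-last L b _ L≤b ⟩
        S v + v b * M b b
          ≈⟨ +-congʳ (sumZ-cong-on L (b ℤ.- + 1) λ b′ L≤b′ b′≤b-1 →
               *-congʳ (agree-below k b′ L≤b′ (i≤j-1⇒i<j b′≤b-1))) ⟨
        S u + v b * M b b ∎))
        where
        S : (ℤ → Carrier) → Carrier
        S w = sumZ L (b ℤ.- + 1) (λ b′ → w b′ * M b b′)

    module Solve (h : ℤ → Carrier) where
      next : ℤ → (ℤ → Carrier) → Carrier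
      next c u = (h c - sumZ L (c ℤ.- + 1) (λ b → u b * M c b)) * M⁻¹ c

      -- solutionUpTo k is the solution on [L, L + k] (and junk elsewhere).
      solutionUpTo : ℕ → ℤ → Carrier
      solutionUpTo zero    b = next L (λ _ → 0#)
      solutionUpTo (suc k) b =
        if does (b ℤ.≤? L ℤ.+ + k) then solutionUpTo k b else next (L ℤ.+ + suc k) (solutionUpTo k)

      solution : ℤ → Carrier
      solution b = solutionUpTo (clamp (b ℤ.- L)) b

      solutionUpTo-stable : ∀ k {b} → b ℤ.≤ L ℤ.+ + k → solutionUpTo (suc k) b ≡ solutionUpTo k b
      solutionUpTo-stable k {b} b≤L+k rewrite dec-true (b ℤ.≤? L ℤ.+ + k) b≤L+k = ≡.refl

      solutionUpTo-new : ∀ k → solutionUpTo (suc k) (L ℤ.+ + suc k) ≡ next (L ℤ.+ + suc k) (solutionUpTo k)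
      solutionUpTo-new k
        rewrite dec-false (L ℤ.+ + suc k ℤ.≤? L ℤ.+ + k) (ℤP.<⇒≱ (i≤j+k⇒i<j+[1+k] L k ℤP.≤-refl)) = ≡.refl

      solution-at : ∀ j → solution (L ℤ.+ + j) ≡ solutionUpTo j (L ℤ.+ + j)
      solution-at j = ≡.cong (λ i → solutionUpTo (clamp i) (L ℤ.+ + j)) (i+j-i≡j L (+ j))

      solution≡solutionUpTo : ∀ j k → j ℕ.≤ k → solution (L ℤ.+ + j) ≡ solutionUpTo k (L ℤ.+ + j)
      solution≡solutionUpTo j k j≤k with j ℕ.≟ k
      ... | yes ≡.refl = solution-at j
      solution≡solutionUpTo zero    zero    _ | no 0≢0 = ⊥-elim (0≢0 ≡.refl)
      solution≡solutionUpTo j (suc k) j≤1+k | no j≢1+k = ≡.trans (solution≡solutionUpTo j k j≤k)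
        (≡.sym (solutionUpTo-stable k (ℤP.+-monoʳ-≤ L (ℤ.+≤+ j≤k))))
        where j≤k = ℕP.≤-pred (ℕP.≤∧≢⇒< j≤1+k j≢1+k)

      next-cong : ∀ c {u v} → (∀ b → L ℤ.≤ b → b ℤ.< c → u b ≈ v b) → next c u ≈ next c v
      next-cong c u≈v = *-congʳ (+-congˡ (-‿cong (sumZ-cong-on L (c ℤ.- + 1)
        λ b L≤b b≤c-1 → *-congʳ (u≈v b L≤b (i≤j-1⇒i<j b≤c-1)))))

      solution-next : ∀ c → L ℤ.≤ c → solution c ≈ next c solution
      solution-next c L≤c with ≤⇒≡+ L≤c
      ... | zero , ≡.refl = trans (reflexive (solution-at 0))
        (trans (reflexive (≡.cong (λ i → next i (λ _ → 0#)) (≡.sym (ℤP.+-identityʳ L))))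
               (next-cong (L ℤ.+ + 0) λ b L≤b b<L+0 →
                  ⊥-elim (ℤP.<⇒≱ (≡.subst (b ℤ.<_) (ℤP.+-identityʳ L) b<L+0) L≤b)))
      ... | suc k , ≡.refl = trans (reflexive (≡.trans (solution-at (suc k)) (solutionUpTo-new k)))
        (next-cong (L ℤ.+ + suc k) λ b L≤b b<c → agree b L≤b (i<j+[1+k]⇒i≤j+k L k b<c))
        where
        agree : ∀ b → L ℤ.≤ b → b ℤ.≤ L ℤ.+ + k → solutionUpTo k b ≈ solution b
        agree b L≤b b≤L+k with ≤⇒≡+ L≤b
        ... | j , ≡.refl = reflexive (≡.sym (solution≡solutionUpTo j k (ℤP.drop‿+≤+ (i+j≤i+k⇒j≤k L b≤L+k))))

      solution-solves : ∀ c → L ℤ.≤ c → lowerSum solution c ≈ h c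
      solution-solves c L≤c = begin
        lowerSum solution c
          ≈⟨ sumZ-last L c _ L≤c ⟩
        S + solution c * M c c
          ≈⟨ +-congˡ (*-congʳ (solution-next c L≤c)) ⟩
        S + (h c - S) * M⁻¹ c * M c c
          ≈⟨ +-congˡ (trans (*-assoc _ _ _) (trans (*-congˡ (trans (*-comm _ _) (M*M⁻¹≈1 c))) (*-identityʳ _))) ⟩
        S + (h c - S)
          ≈⟨ +-congˡ (+-comm _ _) ⟩
        S + (- S + h c)
          ≈⟨ +-assoc _ _ _ ⟨
        S - S + h c
          ≈⟨ +-congʳ (-‿inverseʳ S) ⟩
        0# + h c
          ≈⟨ +-identityˡ _ ⟩
        h c ∎
        where S = sumZ L (c ℤ.- + 1) (λ b → solution b * M c b)

    triangular-surjective : ∀ h → ∃ λ u → ∀ c → L ℤ.≤ c → lowerSum u c ≈ h c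
    triangular-surjective h = Solve.solution h , Solve.solution-solves h

module Recurrence {c ℓ : Level} (F : CZField c ℓ) where
  open CZField F
  open Theory F
  open Arithmetic F
  open Sums F
  open Operators F using (IsDelta⇒low≤1)
  open import Relation.Binary.Reasoning.Setoid setoid
  open import Algebra.Properties.Ring ring using (+-cancelʳ)

  -- Modelled on S n a = coefficient of D^n in τ*(D^(a + e)), for which the recurrence says
  -- τ*(D^(a + e) f(D)) = D τ*(D^(a + e)).
  record IsRecurrent (f : Art) (e : ℤ) (S : ℤ → ℤ → Carrier) : Set ℓ where
    field
      vanishing  : ∀ n a → n ℤ.- e ℤ.< a → S n a ≈ 0#
      recurrence : ∀ n a → sumZ (low f) (n ℤ.- e ℤ.- a) (λ x → atA f x * S n (a ℤ.+ x)) ≈ S (n ℤ.- + 1) a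

  module _ {f : Art} (δ : IsDelta f) {e : ℤ} where

    private
      f₁ : Carrier
      f₁ = atA f (+ 1)

      tail : (ℤ → ℤ → Carrier) → ℕ → ℤ → ℤ → Carrier
      tail X d N A = sumZ (+ 2) (+ suc d) (λ x → atA f x * X N (A ℤ.+ x))

      expand : ∀ {X} → IsRecurrent f e X → ∀ d N A → N ℤ.- e ℤ.- A ≡ + suc d →
               X (N ℤ.- + 1) A ≈ f₁ * X N (A ℤ.+ + 1) + tail X d N A
      expand {X} rec d N A dist = begin
        X (N ℤ.- + 1) A
          ≈⟨ IsRecurrent.recurrence rec N A ⟨
        sumZ (low f) (N ℤ.- e ℤ.- A) (λ x → atA f x * X N (A ℤ.+ x))
          ≈⟨ sumZ-bounds _ ≡.refl dist ⟩
        sumZ (low f) (+ suc d) (λ x → atA f x * X N (A ℤ.+ x))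
          ≈⟨ sumZ-extendˡ (low f) (+ 1) (+ suc d) _ (IsDelta⇒low≤1 f δ)
            (λ x _ x<1 → x≈0⇒x*y≈0 (proj₁ δ x x<1)) ⟩
        sumZ (+ 1) (+ suc d) (λ x → atA f x * X N (A ℤ.+ x))
          ≈⟨ sumZ-first (+ 1) (+ suc d) _ (ℤ.+≤+ (ℕ.s≤s ℕ.z≤n)) ⟩
        f₁ * X N (A ℤ.+ + 1) + tail X d N A ∎

    module _ {S S′ : ℤ → ℤ → Carrier} (S-rec : IsRecurrent f e S) (S′-rec : IsRecurrent f e S′)
             (base : ∀ n → S n (+ 0) ≈ S′ n (+ 0)) where

      private
        Agree : ℕ → Set ℓ
        Agree d = ∀ n a → n ℤ.- e ℤ.- a ≡ + d → S n a ≈ S′ n a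

        -- Expanding the recurrence at distance d + 1, every term except the x = 1 one lies at a smaller distance.
        tail-agree : ∀ d → (∀ {d′} → d′ ℕ.< d → Agree d′) → ∀ N A → N ℤ.- e ℤ.- A ≡ + suc d →
                     tail S d N A ≈ tail S′ d N A
        tail-agree d IH N A dist = sumZ-cong-on (+ 2) (+ suc d) λ x 2≤x x≤1+d →
          *-congˡ (IH (d′<d x 2≤x x≤1+d) N (A ℤ.+ x) (dist′ x x≤1+d))
          where
          d′ : ℤ → ℕ
          d′ x = ℤ.∣ + suc d ℤ.- x ∣
          +d′ : ∀ x → x ℤ.≤ + suc d → + d′ x ≡ + suc d ℤ.- x
          +d′ x x≤1+d = ℤP.0≤i⇒+∣i∣≡i (ℤP.i≤j⇒0≤j-i x≤1+d)
          dist′ : ∀ x → x ℤ.≤ + suc d → N ℤ.- e ℤ.- (A ℤ.+ x) ≡ + d′ x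
          dist′ x x≤1+d = ≡.trans (reassoc N e A x) (≡.trans (≡.cong (ℤ._- x) dist) (≡.sym (+d′ x x≤1+d)))
            where
            reassoc : ∀ N e A x → N ℤ.- e ℤ.- (A ℤ.+ x) ≡ N ℤ.- e ℤ.- A ℤ.- x
            reassoc = solve-∀
          d′<d : ∀ x → + 2 ℤ.≤ x → x ℤ.≤ + suc d → d′ x ℕ.< d
          d′<d x 2≤x x≤1+d = ℤP.drop‿+<+ (≡.subst (ℤ._< + d) (≡.sym (+d′ x x≤1+d))
            (ℤP.≤-<-trans (i-j≤i-k (+ suc d) 2≤x) (≡.subst (ℤ._< + d) (shift (+ d)) (i≤j-1⇒i<j ℤP.≤-refl))))
            where
            shift : ∀ d → d ℤ.- + 1 ≡ + 1 ℤ.+ d ℤ.- + 2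
            shift = solve-∀

        raise : ∀ d → (∀ {d′} → d′ ℕ.< d → Agree d′) → ∀ N A → N ℤ.- e ℤ.- A ≡ + suc d →
                S (N ℤ.- + 1) A ≈ S′ (N ℤ.- + 1) A → S N (A ℤ.+ + 1) ≈ S′ N (A ℤ.+ + 1)
        raise d IH N A dist below =
          *-cancelˡ-invertible _ _ (proj₂ (inv f₁ (proj₂ δ))) (+-cancelʳ (tail S d N A) _ _ (begin
          f₁ * S N (A ℤ.+ + 1) + tail S d N A     ≈⟨ expand S-rec d N A dist ⟨
          S (N ℤ.- + 1) A                         ≈⟨ below ⟩
          S′ (N ℤ.- + 1) A                        ≈⟨ expand S′-rec d N A dist ⟩
          f₁ * S′ N (A ℤ.+ + 1) + tail S′ d N A   ≈⟨ +-congˡ (tail-agree d IH N A dist) ⟨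
          f₁ * S′ N (A ℤ.+ + 1) + tail S d N A    ∎))

        lower : ∀ d → (∀ {d′} → d′ ℕ.< d → Agree d′) → ∀ N A → N ℤ.- e ℤ.- A ≡ + suc d →
                S N (A ℤ.+ + 1) ≈ S′ N (A ℤ.+ + 1) → S (N ℤ.- + 1) A ≈ S′ (N ℤ.- + 1) A
        lower d IH N A dist above = begin
          S (N ℤ.- + 1) A                         ≈⟨ expand S-rec d N A dist ⟩
          f₁ * S N (A ℤ.+ + 1) + tail S d N A     ≈⟨ +-cong (*-congˡ above) (tail-agree d IH N A dist) ⟩
          f₁ * S′ N (A ℤ.+ + 1) + tail S′ d N A   ≈⟨ expand S′-rec d N A dist ⟨
          S′ (N ℤ.- + 1) A                        ∎

        agree-at : ∀ d → (∀ {d′} → d′ ℕ.< d → Agree d′) → Agree d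
        agree-at d IH n a = by-sign a n
          where
          up : ∀ k n → n ℤ.- e ℤ.- + k ≡ + d → S n (+ k) ≈ S′ n (+ k)
          up zero    n _    = base n
          up (suc k) n dist = ≡.subst (λ a → S n a ≈ S′ n a) (≡.cong +_ (ℕP.+-comm k 1))
            (raise d IH n (+ k) (≡.trans (dist₁ n e (+ k)) (≡.cong (λ i → + 1 ℤ.+ i) dist))
              (up k (n ℤ.- + 1) (≡.trans (dist₂ n e (+ k)) dist)))
            where
            dist₁ : ∀ n e k → n ℤ.- e ℤ.- k ≡ + 1 ℤ.+ (n ℤ.- e ℤ.- (+ 1 ℤ.+ k))
            dist₁ = solve-∀
            dist₂ : ∀ n e k → n ℤ.- + 1 ℤ.- e ℤ.- k ≡ n ℤ.- e ℤ.- (+ 1 ℤ.+ k)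
            dist₂ = solve-∀
          down : ∀ k n → n ℤ.- e ℤ.- -[1+ k ] ≡ + d → S n -[1+ k ] ≈ S′ n -[1+ k ]
          down k n dist = ≡.subst (λ m → S m -[1+ k ] ≈ S′ m -[1+ k ]) (i+j-j≡i n (+ 1))
            (lower d IH (n ℤ.+ + 1) -[1+ k ] (≡.trans (dist₁ n e -[1+ k ]) (≡.cong (λ i → + 1 ℤ.+ i) dist))
              (above k (≡.trans (dist₂ n e -[1+ k ]) dist)))
            where
            dist₁ : ∀ n e a → n ℤ.+ + 1 ℤ.- e ℤ.- a ≡ + 1 ℤ.+ (n ℤ.- e ℤ.- a)
            dist₁ = solve-∀
            dist₂ : ∀ n e a → n ℤ.+ + 1 ℤ.- e ℤ.- (a ℤ.+ + 1) ≡ n ℤ.- e ℤ.- a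
            dist₂ = solve-∀
            above : ∀ k → n ℤ.+ + 1 ℤ.- e ℤ.- (-[1+ k ] ℤ.+ + 1) ≡ + d →
                    S (n ℤ.+ + 1) (-[1+ k ] ℤ.+ + 1) ≈ S′ (n ℤ.+ + 1) (-[1+ k ] ℤ.+ + 1)
            above zero    _     = base (n ℤ.+ + 1)
            above (suc k) dist′ = down k (n ℤ.+ + 1) dist′
          by-sign : ∀ a n → n ℤ.- e ℤ.- a ≡ + d → S n a ≈ S′ n a
          by-sign (+ k)    = up k
          by-sign -[1+ k ] = down k

      recurrent-unique : ∀ n a → S n a ≈ S′ n a
      recurrent-unique n a with + 0 ℤ.≤? n ℤ.- e ℤ.- a
      ... | yes 0≤dist = <-rec Agree agree-at ℤ.∣ n ℤ.- e ℤ.- a ∣ n a (≡.sym (ℤP.0≤i⇒+∣i∣≡i 0≤dist))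
      ... | no 0≰dist  = trans (IsRecurrent.vanishing S-rec n a n-e<a) (sym (IsRecurrent.vanishing S′-rec n a n-e<a))
        where
        n-e<a : n ℤ.- e ℤ.< a
        n-e<a = ≡.subst₂ ℤ._<_ (i-j+j≡i (n ℤ.- e) a) (ℤP.+-identityˡ a) (ℤP.+-monoˡ-< a (ℤP.≰⇒> 0≰dist))

module Transfer {c ℓ : Level} (F : CZField c ℓ) where
  open CZField F
  open Theory F
  open Arithmetic F
  open Sums F
  open Operators F
  open Triangular F
  open Recurrence F
  open import Relation.Binary.Reasoning.Setoid setoid
  open import Algebra.Solver.Ring.NaturalCoefficients.Default commutativeSemiring
  open import Algebra.Properties.CommutativeSemigroup *-commutativeSemigroup
    using (x∙yz≈y∙xz) renaming (interchange to *-interchange)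

  module Adjoint {p : ℤ → Ser} {f : Art} (δ : IsDelta f) (p-assoc : IsAssociated f p) where
    open IsAssociated p-assoc

    -- M c b is the coefficient of D^c in τ*(D^b)
    M : ℤ → ℤ → Carrier
    M c b = fact⁻¹ c * (atS (p c) b * fact b)

    M-above : ∀ {c b} → c ℤ.< b → M c b ≈ 0#
    M-above {c} {b} c<b = y≈0⇒x*y≈0 (x≈0⇒x*y≈0 (degree-above c b c<b))

    M-diagonal : ∀ c → M c c ≈ atS (p c) c
    M-diagonal c = trans (x∙yz≈y∙xz _ _ _) (trans (*-congˡ (fact⁻¹*fact≈1 c)) (*-identityʳ _))

    M-diagonal≉0 : ∀ c → ¬ M c c ≈ 0#
    M-diagonal≉0 c Mcc≈0 = degree-top c (trans (sym (M-diagonal c)) Mcc≈0)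

    M-diagonal⁻¹ : ℤ → Carrier
    M-diagonal⁻¹ c = proj₁ (inv (M c c) (M-diagonal≉0 c))

    M*M-diagonal⁻¹≈1 : ∀ c → M c c * M-diagonal⁻¹ c ≈ 1#
    M*M-diagonal⁻¹≈1 c = proj₂ (inv (M c c) (M-diagonal≉0 c))

    M-column₀ : ∀ {c} → c ≢ + 0 → M c (+ 0) ≈ 0#
    M-column₀ {c} c≢0 = y≈0⇒x*y≈0 (x≈0⇒x*y≈0 (norm-≠0 c c≢0))

    M₀₀ : M (+ 0) (+ 0) ≈ 1#
    M₀₀ = trans (*-congˡ (trans (*-congʳ norm-0) (*-identityˡ _))) (fact⁻¹*fact≈1 (+ 0))

    τ* : Art → Art
    τ* h = record { low = low h ; coef = λ c → sumZ (low h) c (λ b → atA h b * M c b) }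

    atA-τ*-from : ∀ h c → atA (τ* h) c ≈ sumZ (low h) c (λ b → atA h b * M c b)
    atA-τ*-from h c with low h ℤ.≤? c
    ... | yes _    = refl
    ... | no low≰c = sym (sumZ-empty (low h) c _ (ℤP.≰⇒> low≰c))

    atA-τ* : ∀ h L c → L ℤ.≤ low h → atA (τ* h) c ≈ sumZ L c (λ b → atA h b * M c b)
    atA-τ* h L c L≤low = trans (atA-τ*-from h c)
      (sym (sumZ-extendˡ L (low h) c _ L≤low λ b _ b<low → x≈0⇒x*y≈0 (atA-below h b<low)))

    private
      pairing : Art → Ser → ℤ → ℤ → Carrier
      pairing h q b c = atA h b * (atS q c * atS (p c) b * fact b)

    ⟨act-τ*⟩-expansion : ∀ h q →
      ⟨ act (τ* h) q ⟩ ≈ sumZ (low h) (top q) (λ b → sumZ (low h) (top q) (pairing h q b))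
    ⟨act-τ*⟩-expansion h q = begin
      ⟨ act (τ* h) q ⟩
        ≈⟨ ⟨act⟩-expansion (τ* h) q ⟩
      sumZ lh tq (λ c → atA (τ* h) c * (atS q c * fact c))
        ≈⟨ sumZ-cong lh tq (λ c →
          trans (*-congʳ (atA-τ*-from h c)) (*-distribʳ-sumZ lh c _ _)) ⟩
      sumZ lh tq (λ c → sumZ lh c (λ b → atA h b * M c b * (atS q c * fact c)))
        ≈⟨ sumZ-cong-on lh tq (λ c _ c≤tq →
          sym (sumZ-extendʳ lh c tq _ c≤tq λ b c<b _ →
            x≈0⇒x*y≈0 (y≈0⇒x*y≈0 (M-above c<b)))) ⟩
      sumZ lh tq (λ c → sumZ lh tq (λ b → atA h b * M c b * (atS q c * fact c)))
        ≈⟨ sumZ-swap lh tq lh tq _ ⟩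
      sumZ lh tq (λ b → sumZ lh tq (λ c → atA h b * M c b * (atS q c * fact c)))
        ≈⟨ sumZ-cong lh tq (λ b → sumZ-cong lh tq λ c →
          trans (reorder _ _ _ _ _ _) (trans (*-congʳ (fact⁻¹*fact≈1 c)) (*-identityˡ _))) ⟩
      sumZ lh tq (λ b → sumZ lh tq (pairing h q b)) ∎
      where
      lh = low h
      tq = top q
      reorder : ∀ x u P k Q v → x * (u * (P * k)) * (Q * v) ≈ (u * v) * (x * (Q * P * k))
      reorder = solve 6 (λ x u P k Q v → x :* (u :* (P :* k)) :* (Q :* v) := (u :* v) :* (x :* (Q :* P :* k))) refl

    ⟨act-transfer⟩-expansion : ∀ h q →
      ⟨ act h (transfer p q) ⟩ ≈ sumZ (low h) (top q) (λ b → sumZ (low h) (top q) (pairing h q b))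
    ⟨act-transfer⟩-expansion h q =
      trans (⟨act⟩-expansion h (transfer p q)) (sumZ-cong-on lh tq λ b lh≤b b≤tq → begin
        atA h b * (atS (transfer p q) b * fact b)
          ≈⟨ *-congˡ (*-congʳ (reflexive (atS-upto (transfer p q) b≤tq))) ⟩
        atA h b * (sumZ b tq (λ c → atS q c * atS (p c) b) * fact b)
          ≈⟨ *-congˡ (*-distribʳ-sumZ b tq _ _) ⟩
        atA h b * sumZ b tq (λ c → atS q c * atS (p c) b * fact b)
          ≈⟨ *-distribˡ-sumZ b tq _ _ ⟩
        sumZ b tq (pairing h q b)
          ≈⟨ sumZ-extendˡ lh b tq _ lh≤b (λ c _ c<b →
               y≈0⇒x*y≈0 (x≈0⇒x*y≈0 (y≈0⇒x*y≈0 (degree-above c b c<b)))) ⟨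
        sumZ lh tq (pairing h q b) ∎)
      where
      lh = low h
      tq = top q

    τ*-adjoint : IsAdjoint (transfer p) τ*
    τ*-adjoint h q = trans (⟨act-τ*⟩-expansion h q) (sym (⟨act-transfer⟩-expansion h q))

    adjoint-unique : ∀ g → IsAdjoint (transfer p) g → ∀ h → τ* h ≈A g h
    adjoint-unique g g-adj h = ≈A-by-basis (τ* h) (g h) λ c →
      trans (τ*-adjoint h (basis c)) (sym (g-adj h (basis c)))

    τ*-cong : ∀ f h → f ≈A h → τ* f ≈A τ* h
    τ*-cong f h f≈h c = trans (atA-τ* f L c (ℤP.i⊓j≤i _ _))
      (trans (sumZ-cong L c λ b → *-congʳ (f≈h b)) (sym (atA-τ* h L c (ℤP.i⊓j≤j _ _))))
      where L = low f ℤ.⊓ low h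

    τ*-+A : ∀ f h → τ* (f +A h) ≈A (τ* f +A τ* h)
    τ*-+A f h c = begin
      atA (τ* (f +A h)) c
        ≈⟨ atA-τ*-from (f +A h) c ⟩
      sumZ L c (λ b → atA (f +A h) b * M c b)
        ≈⟨ sumZ-cong L c (λ b → trans (*-congʳ (atA-+A f h b)) (distribʳ _ _ _)) ⟩
      sumZ L c (λ b → atA f b * M c b + atA h b * M c b)
        ≈⟨ sumZ-+ L c _ _ ⟩
      sumZ L c (λ b → atA f b * M c b) + sumZ L c (λ b → atA h b * M c b)
        ≈⟨ +-cong (atA-τ* f L c (ℤP.i⊓j≤i _ _)) (atA-τ* h L c (ℤP.i⊓j≤j _ _)) ⟨
      atA (τ* f) c + atA (τ* h) c
        ≈⟨ atA-+A (τ* f) (τ* h) c ⟨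
      atA (τ* f +A τ* h) c ∎
      where L = low f ℤ.⊓ low h

    τ*-·A : ∀ k f → τ* (k ·A f) ≈A (k ·A τ* f)
    τ*-·A k f c = begin
      atA (τ* (k ·A f)) c
        ≈⟨ atA-τ*-from (k ·A f) c ⟩
      sumZ (low f) c (λ b → atA (k ·A f) b * M c b)
        ≈⟨ sumZ-cong (low f) c (λ b → trans (*-congʳ (atA-·A k f b)) (*-assoc _ _ _)) ⟩
      sumZ (low f) c (λ b → k * (atA f b * M c b))
        ≈⟨ *-distribˡ-sumZ (low f) c k _ ⟨
      k * sumZ (low f) c (λ b → atA f b * M c b)
        ≈⟨ *-congˡ (atA-τ*-from f c) ⟨
      k * atA (τ* f) c
        ≈⟨ atA-·A k (τ* f) c ⟨
      atA (k ·A τ* f) c ∎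

    τ*-1A : τ* 1A ≈A 1A
    τ*-1A c = trans (atA-τ*-from 1A c) (by-cases c (c ℤ.≟ + 0))
      where
      by-cases : ∀ c → Dec (c ≡ + 0) → sumZ (+ 0) c (λ b → atA 1A b * M c b) ≈ atA 1A c
      by-cases .(+ 0) (yes ≡.refl) =
        trans (sumZ-singleton (+ 0) (λ b → atA 1A b * M (+ 0) b)) (trans (*-identityˡ _) M₀₀)
      by-cases c      (no c≢0)     =
        trans (sumZ-zero (+ 0) c λ b _ _ → term-zero b (b ℤ.≟ + 0)) (sym (atA-1A-≢0 c≢0))
        where
        term-zero : ∀ b → Dec (b ≡ + 0) → atA 1A b * M c b ≈ 0#
        term-zero .(+ 0) (yes ≡.refl) = trans (*-identityˡ _) (M-column₀ c≢0)
        term-zero b      (no b≢0)     = x≈0⇒x*y≈0 (atA-1A-≢0 b≢0)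

    top[p]≥ : ∀ c → c ℤ.≤ top (p c)
    top[p]≥ c = ℤP.≮⇒≥ λ top<c → degree-top c (atS-above (p c) top<c)

    lowering-coefficients : ∀ c j →
      sumZ (low f) (c ℤ.- j) (λ x → atA f x * (atS (p c) (j ℤ.+ x) * ι (Dcoeff (j ℤ.+ x) x))) ≈
      ι ⌊ c ⌉ * atS (p (c ℤ.- + 1)) j
    lowering-coefficients c j = begin
      sumZ (low f) (c ℤ.- j) g
        ≈⟨ sumZ-extendʳ (low f) (c ℤ.- j) (top (p c) ℤ.- j) g
          (ℤP.+-monoˡ-≤ (ℤ.- j) (top[p]≥ c)) (λ x c-j<x _ →
            y≈0⇒x*y≈0 (x≈0⇒x*y≈0 (degree-above c (j ℤ.+ x) (i-j<k⇒i<j+k c j x c-j<x)))) ⟨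
      sumZ (low f) (top (p c) ℤ.- j) g
        ≈⟨ atS-act f (p c) j ⟨
      atS (act f (p c)) j
        ≈⟨ lowering c j ⟩
      atS (scaleS (ι ⌊ c ⌉) (p (c ℤ.- + 1))) j
        ≈⟨ atS-scaleS (ι ⌊ c ⌉) (p (c ℤ.- + 1)) j ⟩
      ι ⌊ c ⌉ * atS (p (c ℤ.- + 1)) j ∎
      where
      g : ℤ → Carrier
      g x = atA f x * (atS (p c) (j ℤ.+ x) * ι (Dcoeff (j ℤ.+ x) x))

    M-lowering : ∀ c j → sumZ (low f) (c ℤ.- j) (λ x → atA f x * M c (j ℤ.+ x)) ≈ M (c ℤ.- + 1) j
    M-lowering c j = begin
      sumZ (low f) (c ℤ.- j) (λ x → atA f x * M c (j ℤ.+ x))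
        ≈⟨ sumZ-cong (low f) (c ℤ.- j) term ⟩
      sumZ (low f) (c ℤ.- j) (λ x → fact⁻¹ c * fact j * g x)
        ≈⟨ *-distribˡ-sumZ (low f) (c ℤ.- j) _ g ⟨
      fact⁻¹ c * fact j * sumZ (low f) (c ℤ.- j) g
        ≈⟨ *-congˡ (lowering-coefficients c j) ⟩
      fact⁻¹ c * fact j * (ι ⌊ c ⌉ * atS (p (c ℤ.- + 1)) j)
        ≈⟨ reorder₄ _ _ _ _ ⟩
      fact⁻¹ c * ι ⌊ c ⌉ * (atS (p (c ℤ.- + 1)) j * fact j)
        ≈⟨ *-congʳ (fact⁻¹*⌊⌉≈fact⁻¹[-1] c) ⟩
      M (c ℤ.- + 1) j ∎
      where
      g : ℤ → Carrier
      g x = atA f x * (atS (p c) (j ℤ.+ x) * ι (Dcoeff (j ℤ.+ x) x))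
      reorder₄ : ∀ u v w z → u * v * (w * z) ≈ u * w * (z * v)
      reorder₄ = solve 4 (λ u v w z → u :* v :* (w :* z) := u :* w :* (z :* v)) refl
      reorder₆ : ∀ u v a P F w → u * v * (a * (P * (F * w))) ≈ v * w * (a * (u * (P * F)))
      reorder₆ = solve 6 (λ u v a P F w → u :* v :* (a :* (P :* (F :* w))) := v :* w :* (a :* (u :* (P :* F)))) refl
      term : ∀ x → atA f x * M c (j ℤ.+ x) ≈ fact⁻¹ c * fact j * g x
      term x = sym (begin
        fact⁻¹ c * fact j * g x
          ≈⟨ *-congˡ (*-congˡ (*-congˡ (ι-Dcoeff j x))) ⟩
        fact⁻¹ c * fact j * (atA f x * (atS (p c) (j ℤ.+ x) * (fact (j ℤ.+ x) * fact⁻¹ j)))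
          ≈⟨ reorder₆ _ _ _ _ _ _ ⟩
        fact j * fact⁻¹ j * (atA f x * M c (j ℤ.+ x))
          ≈⟨ *-congʳ (fact*fact⁻¹≈1 j) ⟩
        1# * (atA f x * M c (j ℤ.+ x))
          ≈⟨ *-identityˡ _ ⟩
        atA f x * M c (j ℤ.+ x) ∎)

    module _ (e : ℤ) where
      private
        S₁ S₂ : ℤ → ℤ → Carrier
        S₁ n a = M n (a ℤ.+ e)
        S₂ n a = sumZ a (n ℤ.- e) (λ c → M c a * M (n ℤ.- c) e)

      S₁-recurrent : IsRecurrent f e S₁
      S₁-recurrent = record
        { vanishing  = λ n a n-e<a → M-above (≡.subst (n ℤ.<_) (ℤP.+-comm e a) (i-j<k⇒i<j+k n e a n-e<a))
        ; recurrence = λ n a → trans (sumZ-bounds _ ≡.refl (reassoc n e a))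
            (trans (sumZ-cong (low f) (n ℤ.- (a ℤ.+ e)) λ x → *-congˡ (reflexive (≡.cong (M n) (swap a x e))))
                   (M-lowering n (a ℤ.+ e)))
        }
        where
        reassoc : ∀ n e a → n ℤ.- e ℤ.- a ≡ n ℤ.- (a ℤ.+ e)
        reassoc = solve-∀
        swap : ∀ a x e → a ℤ.+ x ℤ.+ e ≡ a ℤ.+ e ℤ.+ x
        swap = solve-∀

      S₂-recurrent : IsRecurrent f e S₂
      S₂-recurrent = record
        { vanishing  = λ n a → sumZ-empty a (n ℤ.- e) _
        ; recurrence = recurrence
        }
        where
        recurrence : ∀ n a → sumZ (low f) (n ℤ.- e ℤ.- a) (λ x → atA f x * S₂ n (a ℤ.+ x)) ≈ S₂ (n ℤ.- + 1) a
        recurrence n a = begin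
          sumZ lf U (λ x → atA f x * S₂ n (a ℤ.+ x))
            ≈⟨ sumZ-cong lf U (λ x → *-distribˡ-sumZ (a ℤ.+ x) H _ _) ⟩
          sumZ lf U (λ x → sumZ (a ℤ.+ x) H (T x))
            ≈⟨ sumZ-cong-on lf U (λ x lf≤x _ → sym (sumZ-extendˡ (a ℤ.+ lf) (a ℤ.+ x) H _
              (ℤP.+-monoʳ-≤ a lf≤x) λ c _ c<a+x →
                y≈0⇒x*y≈0 (x≈0⇒x*y≈0 (M-above c<a+x)))) ⟩
          sumZ lf U (λ x → sumZ (a ℤ.+ lf) H (T x))
            ≈⟨ sumZ-swap lf U (a ℤ.+ lf) H T ⟩
          sumZ (a ℤ.+ lf) H (λ c → sumZ lf U (λ x → T x c))
            ≈⟨ sumZ-cong-on (a ℤ.+ lf) H (λ c _ c≤H → lowered c c≤H) ⟩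
          sumZ (a ℤ.+ lf) H (λ c → G (c ℤ.- + 1))
            ≈⟨ sumZ-shift (a ℤ.+ lf) H (ℤ.- + 1) G ⟩
          sumZ (a ℤ.+ lf ℤ.- + 1) (H ℤ.- + 1) G
            ≈⟨ sumZ-extendˡ (a ℤ.+ lf ℤ.- + 1) a (H ℤ.- + 1) G a+lf-1≤a
              (λ c _ c<a → x≈0⇒x*y≈0 (M-above c<a)) ⟩
          sumZ a (H ℤ.- + 1) G
            ≈⟨ sumZ-bounds G ≡.refl (reassoc n e) ⟩
          S₂ (n ℤ.- + 1) a ∎
          where
          lf = low f
          U = n ℤ.- e ℤ.- a
          H = n ℤ.- e
          T : ℤ → ℤ → Carrier
          T x c = atA f x * (M c (a ℤ.+ x) * M (n ℤ.- c) e)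
          G : ℤ → Carrier
          G c = M c a * M (n ℤ.- + 1 ℤ.- c) e
          reassoc : ∀ n e → n ℤ.- e ℤ.- + 1 ≡ n ℤ.- + 1 ℤ.- e
          reassoc = solve-∀
          a+lf-1≤a : a ℤ.+ lf ℤ.- + 1 ℤ.≤ a
          a+lf-1≤a = ≡.subst (a ℤ.+ lf ℤ.- + 1 ℤ.≤_) (i+j-j≡i a (+ 1))
                       (ℤP.+-monoˡ-≤ (ℤ.- + 1) (ℤP.+-monoʳ-≤ a (IsDelta⇒low≤1 f δ)))
          lowered : ∀ c → c ℤ.≤ H → sumZ lf U (λ x → T x c) ≈ G (c ℤ.- + 1)
          lowered c c≤H = begin
            sumZ lf U (λ x → T x c)
              ≈⟨ sumZ-cong lf U (λ x → *-assoc _ _ _) ⟨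
            sumZ lf U (λ x → atA f x * M c (a ℤ.+ x) * M (n ℤ.- c) e)
              ≈⟨ *-distribʳ-sumZ lf U _ _ ⟨
            sumZ lf U (λ x → atA f x * M c (a ℤ.+ x)) * M (n ℤ.- c) e
              ≈⟨ *-congʳ (sumZ-extendʳ lf (c ℤ.- a) U _ (ℤP.+-monoˡ-≤ (ℤ.- a) c≤H)
                λ x c-a<x _ → y≈0⇒x*y≈0 (M-above (i-j<k⇒i<j+k c a x c-a<x))) ⟩
            sumZ lf (c ℤ.- a) (λ x → atA f x * M c (a ℤ.+ x)) * M (n ℤ.- c) e
              ≈⟨ *-cong (M-lowering c a) (reflexive (≡.cong (λ i → M i e) (shift n c))) ⟩
            G (c ℤ.- + 1) ∎
            where
            shift : ∀ n c → n ℤ.- c ≡ n ℤ.- + 1 ℤ.- (c ℤ.- + 1)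
            shift = solve-∀

      private
        base : ∀ n → S₁ n (+ 0) ≈ S₂ n (+ 0)
        base n with + 0 ℤ.≤? n ℤ.- e
        ... | no 0≰n-e = trans (IsRecurrent.vanishing S₁-recurrent n (+ 0) (ℤP.≰⇒> 0≰n-e))
                               (sym (IsRecurrent.vanishing S₂-recurrent n (+ 0) (ℤP.≰⇒> 0≰n-e)))
        ... | yes 0≤n-e = sym (begin
          S₂ n (+ 0)
            ≈⟨ sumZ-single (+ 0) (n ℤ.- e) (+ 0) _ ℤP.≤-refl 0≤n-e
              (λ c _ _ c≢0 → x≈0⇒x*y≈0 (M-column₀ c≢0)) ⟩
          M (+ 0) (+ 0) * M (n ℤ.- + 0) e
            ≈⟨ *-cong M₀₀ (reflexive (≡.cong₂ M (ℤP.+-identityʳ n) (≡.sym (ℤP.+-identityˡ e)))) ⟩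
          1# * S₁ n (+ 0)
            ≈⟨ *-identityˡ _ ⟩
          S₁ n (+ 0) ∎)

      -- τ*(D^(a + e)) = τ*(D^a) τ*(D^e), read off at D^n.
      M-binomial : ∀ n a → M n (a ℤ.+ e) ≈ sumZ a (n ℤ.- e) (λ c → M c a * M (n ℤ.- c) e)
      M-binomial = recurrent-unique δ S₁-recurrent S₂-recurrent base

    τ*-*A : ∀ u v → τ* (u *A v) ≈A (τ* u *A τ* v)
    τ*-*A u v n = begin
      atA (τ* (u *A v)) n
        ≈⟨ atA-τ*-from (u *A v) n ⟩
      sumZ (lu ℤ.+ lv) n (λ b → atA (u *A v) b * M n b)
        ≈⟨ sumZ-cong-on (lu ℤ.+ lv) n (λ b _ b≤n →
          trans (*-congʳ (atA-*A u v b lu (n ℤ.- lv) ℤP.≤-refl (ℤP.+-monoˡ-≤ (ℤ.- lv) b≤n)))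
                (*-distribʳ-sumZ lu (n ℤ.- lv) _ _)) ⟩
      sumZ (lu ℤ.+ lv) n (λ b → sumZ lu (n ℤ.- lv) (λ a → atA u a * atA v (b ℤ.- a) * M n b))
        ≈⟨ sumZ-swap (lu ℤ.+ lv) n lu (n ℤ.- lv) _ ⟩
      sumZ lu (n ℤ.- lv) (λ a → sumZ (lu ℤ.+ lv) n (λ b → atA u a * atA v (b ℤ.- a) * M n b))
        ≈⟨ sumZ-cong-on lu (n ℤ.- lv) (λ a lu≤a _ → expand-product a lu≤a) ⟩
      sumZ lu (n ℤ.- lv) (λ a → sumZ lv (n ℤ.- lu) (λ e → sumZ lu (n ℤ.- lv) (W a e)))
        ≈⟨ sumZ-cong lu (n ℤ.- lv) (λ a → sumZ-swap lv (n ℤ.- lu) lu (n ℤ.- lv) (W a)) ⟩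
      sumZ lu (n ℤ.- lv) (λ a → sumZ lu (n ℤ.- lv) (λ c → sumZ lv (n ℤ.- lu) (λ e → W a e c)))
        ≈⟨ sumZ-swap lu (n ℤ.- lv) lu (n ℤ.- lv) _ ⟩
      sumZ lu (n ℤ.- lv) (λ c → sumZ lu (n ℤ.- lv) (λ a → sumZ lv (n ℤ.- lu) (λ e → W a e c)))
        ≈⟨ sumZ-cong-on lu (n ℤ.- lv) (λ c lu≤c c≤n-lv → expand-factors c lu≤c c≤n-lv) ⟨
      sumZ lu (n ℤ.- lv) (λ c → atA (τ* u) c * atA (τ* v) (n ℤ.- c))
        ≈⟨ atA-*A (τ* u) (τ* v) n lu (n ℤ.- lv) ℤP.≤-refl ℤP.≤-refl ⟨
      atA (τ* u *A τ* v) n ∎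
      where
      lu = low u
      lv = low v
      W : ℤ → ℤ → ℤ → Carrier
      W a e c = atA u a * atA v e * (M c a * M (n ℤ.- c) e)
      W-left : ∀ {a e c} → c ℤ.< a → W a e c ≈ 0#
      W-left c<a = y≈0⇒x*y≈0 (x≈0⇒x*y≈0 (M-above c<a))
      W-right : ∀ {a e c} → n ℤ.- c ℤ.< e → W a e c ≈ 0#
      W-right n-c<e = y≈0⇒x*y≈0 (y≈0⇒x*y≈0 (M-above n-c<e))

      expand-product : ∀ a → lu ℤ.≤ a →
        sumZ (lu ℤ.+ lv) n (λ b → atA u a * atA v (b ℤ.- a) * M n b) ≈
        sumZ lv (n ℤ.- lu) (λ e → sumZ lu (n ℤ.- lv) (W a e))
      expand-product a lu≤a = begin
        sumZ (lu ℤ.+ lv) n (λ b → atA u a * atA v (b ℤ.- a) * M n b)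
          ≈⟨ sumZ-bounds _ (i-j+j≡i (lu ℤ.+ lv) a) (i-j+j≡i n a) ⟨
        sumZ (lu ℤ.+ lv ℤ.- a ℤ.+ a) (n ℤ.- a ℤ.+ a) (λ b → atA u a * atA v (b ℤ.- a) * M n b)
          ≈⟨ sumZ-shift (lu ℤ.+ lv ℤ.- a) (n ℤ.- a) a _ ⟨
        sumZ (lu ℤ.+ lv ℤ.- a) (n ℤ.- a) (λ e → atA u a * atA v (e ℤ.+ a ℤ.- a) * M n (e ℤ.+ a))
          ≈⟨ sumZ-cong (lu ℤ.+ lv ℤ.- a) (n ℤ.- a) (λ e →
            reflexive (≡.cong₂ (λ i j → atA u a * atA v i * M n j) (i+j-j≡i e a) (ℤP.+-comm e a))) ⟩
        sumZ (lu ℤ.+ lv ℤ.- a) (n ℤ.- a) (λ e → atA u a * atA v e * M n (a ℤ.+ e))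
          ≈⟨ sumZ-extendˡ (lu ℤ.+ lv ℤ.- a) lv (n ℤ.- a) _ lu+lv-a≤lv
            (λ e _ e<lv → x≈0⇒x*y≈0 (y≈0⇒x*y≈0 (atA-below v e<lv))) ⟩
        sumZ lv (n ℤ.- a) (λ e → atA u a * atA v e * M n (a ℤ.+ e))
          ≈⟨ sumZ-cong lv (n ℤ.- a) (λ e →
            trans (*-congˡ (M-binomial e n a)) (*-distribˡ-sumZ a (n ℤ.- e) _ _)) ⟩
        sumZ lv (n ℤ.- a) (λ e → sumZ a (n ℤ.- e) (W a e))
          ≈⟨ sumZ-extendʳ lv (n ℤ.- a) (n ℤ.- lu) _ (i-j≤i-k n lu≤a)
            (λ e n-a<e _ → sumZ-empty a (n ℤ.- e) _ (i-j<k⇒i-k<j n a e n-a<e)) ⟨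
        sumZ lv (n ℤ.- lu) (λ e → sumZ a (n ℤ.- e) (W a e))
          ≈⟨ sumZ-cong-on lv (n ℤ.- lu) (λ e lv≤e _ →
            sumZ-restrict lu a (n ℤ.- e) (n ℤ.- lv) (W a e) lu≤a (i-j≤i-k n lv≤e)
              (λ c _ c<a → W-left c<a) (λ c n-e<c _ → W-right (i-j<k⇒i-k<j n e c n-e<c))) ⟨
        sumZ lv (n ℤ.- lu) (λ e → sumZ lu (n ℤ.- lv) (W a e)) ∎
        where
        lu+lv-a≤lv : lu ℤ.+ lv ℤ.- a ℤ.≤ lv
        lu+lv-a≤lv = ≡.subst (lu ℤ.+ lv ℤ.- a ℤ.≤_) (i+j-i≡j lu lv) (i-j≤i-k (lu ℤ.+ lv) lu≤a)

      expand-factors : ∀ c → lu ℤ.≤ c → c ℤ.≤ n ℤ.- lv →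
        atA (τ* u) c * atA (τ* v) (n ℤ.- c) ≈ sumZ lu (n ℤ.- lv) (λ a → sumZ lv (n ℤ.- lu) (λ e → W a e c))
      expand-factors c lu≤c c≤n-lv = begin
        atA (τ* u) c * atA (τ* v) (n ℤ.- c)
          ≈⟨ *-cong (atA-τ*-from u c) (atA-τ*-from v (n ℤ.- c)) ⟩
        sumZ lu c (λ a → atA u a * M c a) * sumZ lv (n ℤ.- c) (λ e → atA v e * M (n ℤ.- c) e)
          ≈⟨ sumZ-*-sumZ lu c lv (n ℤ.- c) _ _ ⟩
        sumZ lu c (λ a → sumZ lv (n ℤ.- c) (λ e → atA u a * M c a * (atA v e * M (n ℤ.- c) e)))
          ≈⟨ sumZ-cong lu c (λ a → sumZ-cong lv (n ℤ.- c) λ e → *-interchange _ _ _ _) ⟩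
        sumZ lu c (λ a → sumZ lv (n ℤ.- c) (λ e → W a e c))
          ≈⟨ sumZ-cong lu c (λ a → sumZ-extendʳ lv (n ℤ.- c) (n ℤ.- lu) _ (i-j≤i-k n lu≤c)
            λ e n-c<e _ → W-right n-c<e) ⟨
        sumZ lu c (λ a → sumZ lv (n ℤ.- lu) (λ e → W a e c))
          ≈⟨ sumZ-extendʳ lu c (n ℤ.- lv) _ c≤n-lv
            (λ a c<a _ → sumZ-zero lv (n ℤ.- lu) λ e _ _ → W-left c<a) ⟨
        sumZ lu (n ℤ.- lv) (λ a → sumZ lv (n ℤ.- lu) (λ e → W a e c)) ∎

    τ*-injective : ∀ u v → τ* u ≈A τ* v → u ≈A v
    τ*-injective u v τu≈τv b with b ℤ.<? low u ℤ.⊓ low v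
    ... | yes b<L = trans (atA-below u (ℤP.<-≤-trans b<L (ℤP.i⊓j≤i _ _)))
                          (sym (atA-below v (ℤP.<-≤-trans b<L (ℤP.i⊓j≤j _ _))))
    ... | no b≮L  = triangular-injective (atA u) (atA v) (λ c _ →
                      trans (sym (atA-τ* u L c (ℤP.i⊓j≤i _ _))) (trans (τu≈τv c) (atA-τ* v L c (ℤP.i⊓j≤j _ _))))
                      b (ℤP.≮⇒≥ b≮L)
      where
      L = low u ℤ.⊓ low v
      open System L M M-diagonal⁻¹ M*M-diagonal⁻¹≈1

    τ*-surjective : ∀ h L → (∀ b → b ℤ.< L → atA h b ≈ 0#) → ∃ λ u → low u ≡ L × τ* u ≈A h
    τ*-surjective h L h≈0 = u , ≡.refl , τu≈h
      where
      open System L M M-diagonal⁻¹ M*M-diagonal⁻¹≈1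
      solution = proj₁ (triangular-surjective (atA h))
      u : Art
      u = record { low = L ; coef = solution }
      τu≈h : τ* u ≈A h
      τu≈h c with c ℤ.<? L
      ... | yes c<L = trans (atA-τ*-from u c) (trans (sumZ-empty L c _ c<L) (sym (h≈0 c c<L)))
      ... | no c≮L  = trans (atA-τ*-from u c) (trans
                        (sumZ-cong-on L c λ b L≤b _ → *-congʳ (reflexive (atA-from u L≤b)))
                        (proj₂ (triangular-surjective (atA h)) c (ℤP.≮⇒≥ c≮L)))

    τ*-isAutΛ⁺ : IsAutΛ⁺ τ*
    τ*-isAutΛ⁺ = record
      { cong       = τ*-cong
      ; +-homo     = τ*-+A
      ; ·-homo     = τ*-·A
      ; *-homo     = τ*-*A
      ; 1-homo     = τ*-1A
      ; injective  = τ*-injective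
      ; surjective = λ h → let (u , _ , τu≈h) = τ*-surjective h (low h) (λ b → atA-below h) in u , τu≈h
      }

    τ*-IsDiff : ∀ h → IsDiff h → IsDiff (τ* h)
    τ*-IsDiff h h-diff a a<0 = trans (atA-τ*-from h a)
      (sumZ-zero (low h) a λ b _ b≤a → x≈0⇒x*y≈0 (h-diff b (ℤP.≤-<-trans b≤a a<0)))

    ⟨act-transfer-restrict₀⟩ : ∀ h q → IsDiff h →
      ⟨ act h (transfer p (restrict₀ q)) ⟩ ≈ ⟨ act h (restrict₀ (transfer₀ p q)) ⟩
    ⟨act-transfer-restrict₀⟩ h q h-diff = trans (⟨act⟩-expansion h (transfer p (restrict₀ q)))
      (trans (sumZ-cong-on (low h) (top q) λ b _ b≤top → term b b≤top (+ 0 ℤ.≤? b))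
             (sym (⟨act⟩-expansion h (restrict₀ (transfer₀ p q)))))
      where
      term : ∀ b → b ℤ.≤ top q → Dec (+ 0 ℤ.≤ b) →
             atA h b * (atS (transfer p (restrict₀ q)) b * fact b) ≈
             atA h b * (atS (restrict₀ (transfer₀ p q)) b * fact b)
      term b _ (no 0≰b) = trans (x≈0⇒x*y≈0 (h-diff b (ℤP.≰⇒> 0≰b))) (sym (x≈0⇒x*y≈0 (h-diff b (ℤP.≰⇒> 0≰b))))
      term b b≤top (yes 0≤b) = *-congˡ (*-congʳ (begin
        atS (transfer p (restrict₀ q)) b
          ≡⟨ atS-upto (transfer p (restrict₀ q)) b≤top ⟩
        sumZ b (top q) (λ c → atS (restrict₀ q) c * atS (p c) b)
          ≈⟨ sumZ-cong b (top q) (λ c →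
            *-cong (atS-restrict₀ q c) (reflexive (≡.sym (atS0-nonneg (p c) 0≤b)))) ⟩
        sumZ b (top q) (λ c → atS0 q c * atS0 (p c) b)
          ≡⟨ atS-upto (transfer₀ p q) b≤top ⟨
        atS (transfer₀ p q) b
          ≡⟨ atS0-nonneg (transfer₀ p q) 0≤b ⟨
        atS0 (transfer₀ p q) b
          ≈⟨ atS-restrict₀ (transfer₀ p q) b ⟨
        atS (restrict₀ (transfer₀ p q)) b ∎))

    τ*-adjoint₀ : IsAdjoint₀ (transfer₀ p) τ*
    τ*-adjoint₀ h h-diff = τ*-IsDiff h h-diff , λ q → begin
      ⟨ act₀ (τ* h) q ⟩₀                           ≈⟨ ⟨act₀⟩₀≈⟨act-restrict₀⟩ (τ* h) q ⟩
      ⟨ act (τ* h) (restrict₀ q) ⟩                 ≈⟨ τ*-adjoint h (restrict₀ q) ⟩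
      ⟨ act h (transfer p (restrict₀ q)) ⟩         ≈⟨ ⟨act-transfer-restrict₀⟩ h q h-diff ⟩
      ⟨ act h (restrict₀ (transfer₀ p q)) ⟩        ≈⟨ ⟨act₀⟩₀≈⟨act-restrict₀⟩ h (transfer₀ p q) ⟨
      ⟨ act₀ h (transfer₀ p q) ⟩₀                  ∎

    adjoint₀-unique : ∀ g → IsAdjoint₀ (transfer₀ p) g → ∀ h → IsDiff h → τ* h ≈A g h
    adjoint₀-unique g g-adj h h-diff =
      ≈A-by-basis₀ (τ* h) (g h) (τ*-IsDiff h h-diff) (proj₁ (g-adj h h-diff)) λ c _ →
        trans (proj₂ (τ*-adjoint₀ h h-diff) (basis c)) (sym (proj₂ (g-adj h h-diff) (basis c)))

    τ*-isAutΛ : IsAutΛ τ*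
    τ*-isAutΛ = record
      { closed     = τ*-IsDiff
      ; cong       = λ f h _ _ → τ*-cong f h
      ; +-homo     = λ f h _ _ → τ*-+A f h
      ; ·-homo     = λ k f _ → τ*-·A k f
      ; *-homo     = λ f h _ _ → τ*-*A f h
      ; 1-homo     = τ*-1A
      ; injective  = λ f h _ _ → τ*-injective f h
      ; surjective = surjective
      }
      where
      surjective : ∀ h → IsDiff h → ∃ λ u → IsDiff u × (τ* u ≈A h)
      surjective h h-diff =
        let (u , low≡ , τu≈h) = τ*-surjective h (low h ℤ.⊔ + 0) below
        in u , 0≤low⇒IsDiff u (≡.subst (+ 0 ℤ.≤_) (≡.sym low≡) (ℤP.i≤j⊔i _ _)) , τu≈h
        where
        below : ∀ b → b ℤ.< low h ℤ.⊔ + 0 → atA h b ≈ 0#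
        below b b<max with b ℤ.<? + 0
        ... | yes b<0 = h-diff b b<0
        ... | no b≮0  = atA-below h (ℤP.≰⇒> λ low≤b → ℤP.<⇒≱ b<max (ℤP.⊔-lub low≤b (ℤP.≮⇒≥ b≮0)))

mainTheorem1 : ∀ {c ℓ : Level} (F : CZField c ℓ) → let open Theory F in
    (p : ℤ → Ser) → IsRoman p →
      (Σ (Art → Art) (IsAdjoint (transfer p))
        × (∀ g → IsAdjoint (transfer p) g → IsAutΛ⁺ g))
    × (Σ (Art → Art) (IsAdjoint₀ (transfer₀ p))
        × (∀ g → IsAdjoint₀ (transfer₀ p) g → IsAutΛ g))
mainTheorem1 F p (f , δ , p-assoc) =
    ((τ* , τ*-adjoint) , λ g g-adj → IsAutΛ⁺-resp (adjoint-unique g g-adj) τ*-isAutΛ⁺)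
  , ((τ* , τ*-adjoint₀) , λ g g-adj → IsAutΛ-resp (adjoint₀-unique g g-adj) τ*-isAutΛ)
  where
  open Operators F using (IsAutΛ⁺-resp; IsAutΛ-resp)
  open Transfer.Adjoint F δ p-assoc
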